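{- Let $n$ be a positive integer and let $A\in\{ -1,0,1\}^{n\times n}$ have exactly $t$ non-zero entries. Then $|\det(A)|\leq (t/n)^{n/2}$. Moreover, this bound is attained by some such matrix $A$ whenever $t/n$ and $n^2/t$ are integers and there exists a Hadamard matrix of order $t/n$.
   Context: A Hadamard matrix of order $k$ is a matrix $H\in\{ -1,1\}^{k\times k}$ with $|\det(H)|=k^{k/2}$ (equivalently $HH^{\mathsf T}=k\,\mathrm{Id}_k$). -}

module Defs where

open import Data.Nat as ℕ using (ℕ; zero; suc)
open import Data.Integer as ℤ using (ℤ; +_; -_)
open import Data.Fin using (Fin; zero; suc; punchIn)
open import Data.Product using (_×_)
open import Data.Sum using (_⊎_)
open import Relation.Binary.PropositionalEquality using (_≡_)
open import Relation.Nullary.Decidable using (does)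

Matrix : ℕ → Set
Matrix n = Fin n → Fin n → ℤ

sumℤ : ∀ n → (Fin n → ℤ) → ℤ
sumℤ zero    f = + 0
sumℤ (suc n) f = f zero ℤ.+ sumℤ n (λ i → f (suc i))

sumℕ : ∀ n → (Fin n → ℕ) → ℕ
sumℕ zero    f = 0
sumℕ (suc n) f = f zero ℕ.+ sumℕ n (λ i → f (suc i))

sign : ℕ → ℤ
sign zero    = + 1
sign (suc k) = - sign k

minor : ∀ {n} → Matrix (suc n) → Fin (suc n) → Matrix n
minor M j i k = M (suc i) (punchIn j k)

det : ∀ {n} → Matrix n → ℤ
det {zero}  M = + 1
det {suc n} M = sumℤ (suc n) (λ j → sign (Data.Fin.toℕ j) ℤ.* (M zero j ℤ.* det (minor M j)))

IsTernary : ∀ {n} → Matrix n → Set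
IsTernary {n} A = ∀ i j → (A i j ≡ - + 1) ⊎ ((A i j ≡ + 0) ⊎ (A i j ≡ + 1))

IsSignMatrix : ∀ {n} → Matrix n → Set
IsSignMatrix {n} A = ∀ i j → (A i j ≡ - + 1) ⊎ (A i j ≡ + 1)

nonZeroCount : ∀ {n} → Matrix n → ℕ
nonZeroCount {n} A =
  sumℕ n (λ i → sumℕ n (λ j → if does (A i j ℤ.≟ + 0) then 0 else 1))
  where open import Data.Bool using (if_then_else_)

-- Hadamard matrix of order k: H ∈ {-1,1}^{k×k} with |det H| = k^{k/2},
-- stated without square roots as |det H|^2 = k^k
IsHadamard : ∀ k → Matrix k → Set
IsHadamard k H = IsSignMatrix H × (ℤ.∣ det H ∣ ℕ.^ 2 ≡ k ℕ.^ k)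

module Submission where

-- Hadamard's inequality |det A|² ≤ ∏ᵢ ‖Aᵢ‖² bounds |det A|² for a {-1,0,1}-matrix by the product of
-- the numbers tᵢ of non-zero entries in its rows, and AM–GM bounds that product by (t/n)ⁿ.
-- Hadamard's inequality is proved for Gram determinants det(BBᵀ) by induction on the number m + 1 of
-- rows: with N₀ = ‖b₀‖², replacing every other row bᵢ by N₀ bᵢ - ⟨bᵢ , b₀⟩ b₀ multiplies det(BBᵀ) by
-- N₀^2m, makes it N₀ times the Gram determinant of the new rows, and multiplies each squared row norm by
-- at most N₀². The determinant identities this uses, det(AB) = det A det B and det Aᵀ = det A, follow
-- from the uniqueness of normalised alternating multilinear forms.
-- Equality: the block diagonal matrix of n/k copies of a Hadamard matrix of order k has t = kn
-- non-zero entries and |det|² = (kᵏ)^(n/k) = kⁿ = (t/n)ⁿ.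

open import Defs

module Determinant where

  open import Data.Nat as ℕ using (ℕ; zero; suc)
  import Data.Nat.Properties as ℕₚ
  open import Data.Integer as ℤ using (ℤ; _+_; _*_; _-_; -_; 0ℤ; 1ℤ; -1ℤ)
  open import Data.Integer.Properties hiding (_≟_)
  open import Data.Integer.Tactic.RingSolver using (solve-∀)
  open import Data.Fin using (Fin; zero; suc; punchIn; punchOut; toℕ; fromℕ<; inject₁; _≟_)
  open import Data.Fin.Properties
    using (suc-injective; toℕ<n; toℕ-injective; toℕ-fromℕ<; toℕ-inject₁;
           punchIn-injective; punchInᵢ≢i; punchOut-cong; punchIn-punchOut; punchOut-punchIn)
  open import Data.Fin.Permutation.Components using (transpose)
  open import Data.Vec.Functional using (insertAt)
  open import Data.Vec.Functional.Properties using (insertAt-lookup; insertAt-punchIn)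
  open import Data.Empty using (⊥-elim)
  open import Relation.Nullary using (Dec; yes; no)
  open import Relation.Nullary.Decidable using (dec-true; dec-false)
  open import Relation.Binary.PropositionalEquality
  open import Function using (_∘_)
  open ≡-Reasoning

  sumℤ-cong : ∀ n {f g : Fin n → ℤ} → (∀ i → f i ≡ g i) → sumℤ n f ≡ sumℤ n g
  sumℤ-cong zero    f≗g = refl
  sumℤ-cong (suc n) f≗g = cong₂ _+_ (f≗g zero) (sumℤ-cong n (f≗g ∘ suc))

  sumℤ-zero : ∀ n {f : Fin n → ℤ} → (∀ i → f i ≡ 0ℤ) → sumℤ n f ≡ 0ℤ
  sumℤ-zero zero    f≗0 = refl
  sumℤ-zero (suc n) f≗0 = cong₂ _+_ (f≗0 zero) (sumℤ-zero n (f≗0 ∘ suc))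

  sumℤ-+ : ∀ n (f g : Fin n → ℤ) → sumℤ n (λ i → f i + g i) ≡ sumℤ n f + sumℤ n g
  sumℤ-+ zero    f g = refl
  sumℤ-+ (suc n) f g =
    trans (cong (f zero + g zero +_) (sumℤ-+ n (f ∘ suc) (g ∘ suc)))
          (interchange (f zero) (g zero) (sumℤ n (f ∘ suc)) (sumℤ n (g ∘ suc)))
    where
    interchange : ∀ a b c d → (a + b) + (c + d) ≡ (a + c) + (b + d)
    interchange = solve-∀

  sumℤ-*ˡ : ∀ n x (f : Fin n → ℤ) → sumℤ n (λ i → x * f i) ≡ x * sumℤ n f
  sumℤ-*ˡ zero    x f = sym (*-zeroʳ x)
  sumℤ-*ˡ (suc n) x f =
    trans (cong (x * f zero +_) (sumℤ-*ˡ n x (f ∘ suc))) (sym (*-distribˡ-+ x (f zero) _))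

  sumℤ-*ʳ : ∀ n x (f : Fin n → ℤ) → sumℤ n (λ i → f i * x) ≡ sumℤ n f * x
  sumℤ-*ʳ n x f = trans (sumℤ-cong n (λ i → *-comm (f i) x)) (trans (sumℤ-*ˡ n x f) (*-comm x _))

  sumℤ-linear : ∀ n x y (f g : Fin n → ℤ) →
                sumℤ n (λ i → x * f i + y * g i) ≡ x * sumℤ n f + y * sumℤ n g
  sumℤ-linear n x y f g = trans (sumℤ-+ n _ _) (cong₂ _+_ (sumℤ-*ˡ n x f) (sumℤ-*ˡ n y g))

  sumℤ-neg : ∀ n (f : Fin n → ℤ) → sumℤ n (λ i → - f i) ≡ - sumℤ n f
  sumℤ-neg zero    f = refl
  sumℤ-neg (suc n) f =
    trans (cong (- f zero +_) (sumℤ-neg n (f ∘ suc))) (sym (neg-distrib-+ (f zero) _))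

  sumℤ-swap : ∀ m n (f : Fin m → Fin n → ℤ) →
              sumℤ m (λ i → sumℤ n (f i)) ≡ sumℤ n (λ j → sumℤ m (λ i → f i j))
  sumℤ-swap zero    n f = sym (sumℤ-zero n (λ _ → refl))
  sumℤ-swap (suc m) n f =
    trans (cong (sumℤ n (f zero) +_) (sumℤ-swap m n (f ∘ suc)))
          (sym (sumℤ-+ n (f zero) (λ j → sumℤ m (λ i → f (suc i) j))))

  sumℤ-single : ∀ n (k : Fin n) (f : Fin n → ℤ) → (∀ i → i ≢ k → f i ≡ 0ℤ) → sumℤ n f ≡ f k
  sumℤ-single (suc n) zero f f≗0 =
    trans (cong (f zero +_) (sumℤ-zero n (λ i → f≗0 (suc i) λ ()))) (+-identityʳ _)
  sumℤ-single (suc n) (suc k) f f≗0 =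
    trans (cong₂ _+_ (f≗0 zero λ ()) (sumℤ-single n k (f ∘ suc) (λ i i≢k → f≗0 (suc i) (i≢k ∘ suc-injective))))
          (+-identityˡ _)

  sumℤ-punchIn : ∀ n (j : Fin (suc n)) (f : Fin (suc n) → ℤ) →
                 sumℤ (suc n) f ≡ f j + sumℤ n (f ∘ punchIn j)
  sumℤ-punchIn n       zero    f = refl
  sumℤ-punchIn (suc n) (suc j) f =
    trans (cong (f zero +_) (sumℤ-punchIn n j (f ∘ suc))) (left-comm (f zero) (f (suc j)) _)
    where
    left-comm : ∀ a b c → a + (b + c) ≡ b + (a + c)
    left-comm = solve-∀

  i≡-i⇒i≡0 : ∀ i → i ≡ - i → i ≡ 0ℤ
  i≡-i⇒i≡0 i i≡-i = *-cancelˡ-≡ (ℤ.+ 2) i 0ℤ (begin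
    ℤ.+ 2 * i ≡⟨ double i ⟩
    i + i     ≡⟨ cong (i +_) i≡-i ⟩
    i + - i   ≡⟨ +-inverseʳ i ⟩
    0ℤ        ≡⟨ sym (*-zeroʳ (ℤ.+ 2)) ⟩
    ℤ.+ 2 * 0ℤ ∎)
    where
    double : ∀ i → ℤ.+ 2 * i ≡ i + i
    double = solve-∀

  laplaceTerm : ∀ {n} → Matrix (suc n) → Fin (suc n) → ℤ
  laplaceTerm M j = sign (toℕ j) * (M zero j * det (minor M j))

  det-cong : ∀ n {A B : Matrix n} → (∀ i j → A i j ≡ B i j) → det A ≡ det B
  det-cong zero    A≗B = refl
  det-cong (suc n) A≗B = sumℤ-cong (suc n) λ j →
    cong₂ (λ a d → sign (toℕ j) * (a * d)) (A≗B zero j) (det-cong n (λ i k → A≗B (suc i) (punchIn j k)))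

  det-rowLinear : ∀ n (r : Fin n) (A B C : Matrix n) (x y : ℤ) →
                  (∀ i j → i ≢ r → A i j ≡ B i j) → (∀ i j → i ≢ r → A i j ≡ C i j) →
                  (∀ j → A r j ≡ x * B r j + y * C r j) → det A ≡ x * det B + y * det C
  det-rowLinear (suc n) zero A B C x y A≈B A≈C Aᵣ =
    trans (sumℤ-cong (suc n) term) (sumℤ-linear (suc n) x y (laplaceTerm B) (laplaceTerm C))
    where
    term : ∀ j → laplaceTerm A j ≡ x * laplaceTerm B j + y * laplaceTerm C j
    term j = begin
      s * (A zero j * det (minor A j))
        ≡⟨ cong (λ a → s * (a * det (minor A j))) (Aᵣ j) ⟩
      s * ((x * B zero j + y * C zero j) * det (minor A j))
        ≡⟨ distrib s x y (B zero j) (C zero j) (det (minor A j)) ⟩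
      x * (s * (B zero j * det (minor A j))) + y * (s * (C zero j * det (minor A j)))
        ≡⟨ cong₂ (λ d d′ → x * (s * (B zero j * d)) + y * (s * (C zero j * d′)))
                 (det-cong n (λ i k → A≈B (suc i) (punchIn j k) λ ()))
                 (det-cong n (λ i k → A≈C (suc i) (punchIn j k) λ ())) ⟩
      x * laplaceTerm B j + y * laplaceTerm C j ∎
      where
      s = sign (toℕ j)
      distrib : ∀ s x y b c d → s * ((x * b + y * c) * d) ≡ x * (s * (b * d)) + y * (s * (c * d))
      distrib = solve-∀
  det-rowLinear (suc n) (suc r) A B C x y A≈B A≈C Aᵣ =
    trans (sumℤ-cong (suc n) term) (sumℤ-linear (suc n) x y (laplaceTerm B) (laplaceTerm C))
    where
    term : ∀ j → laplaceTerm A j ≡ x * laplaceTerm B j + y * laplaceTerm C j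
    term j = begin
      s * (A zero j * det (minor A j))
        ≡⟨ cong (λ d → s * (A zero j * d))
                (det-rowLinear n r (minor A j) (minor B j) (minor C j) x y
                   (λ i k i≢r → A≈B (suc i) (punchIn j k) (i≢r ∘ suc-injective))
                   (λ i k i≢r → A≈C (suc i) (punchIn j k) (i≢r ∘ suc-injective))
                   (Aᵣ ∘ punchIn j)) ⟩
      s * (A zero j * (x * det (minor B j) + y * det (minor C j)))
        ≡⟨ distrib s x y (A zero j) (det (minor B j)) (det (minor C j)) ⟩
      x * (s * (A zero j * det (minor B j))) + y * (s * (A zero j * det (minor C j)))
        ≡⟨ cong₂ (λ b c → x * (s * (b * det (minor B j))) + y * (s * (c * det (minor C j))))
                 (A≈B zero j λ ()) (A≈C zero j λ ()) ⟩
      x * laplaceTerm B j + y * laplaceTerm C j ∎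
      where
      s = sign (toℕ j)
      distrib : ∀ s x y a d e → s * (a * (x * d + y * e)) ≡ x * (s * (a * d)) + y * (s * (a * e))
      distrib = solve-∀

  det-firstRowPivot : ∀ n (A : Matrix (suc n)) → (∀ j → j ≢ zero → A zero j ≡ 0ℤ) →
                      det A ≡ A zero zero * det (minor A zero)
  det-firstRowPivot n A A₀≗0 = trans (sumℤ-single (suc n) zero (laplaceTerm A) vanish) (*-identityˡ _)
    where
    vanish : ∀ j → j ≢ zero → laplaceTerm A j ≡ 0ℤ
    vanish j j≢0 = trans (cong (λ a → sign (toℕ j) * (a * det (minor A j))) (A₀≗0 j j≢0))
                         (*-zeroʳ (sign (toℕ j)))

  det-zeroFirstRow : ∀ n (A : Matrix (suc n)) → (∀ j → A zero j ≡ 0ℤ) → det A ≡ 0ℤ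
  det-zeroFirstRow n A A₀≗0 = sumℤ-zero (suc n) λ j →
    trans (cong (λ a → sign (toℕ j) * (a * det (minor A j))) (A₀≗0 j)) (*-zeroʳ (sign (toℕ j)))

  punchIn-punchIn-comm : ∀ n (j c : Fin (suc (suc n))) (j≢c : j ≢ c) (l : Fin n) →
                         punchIn j (punchIn (punchOut j≢c) l) ≡ punchIn c (punchIn (punchOut (j≢c ∘ sym)) l)
  punchIn-punchIn-comm n       zero    zero    j≢c l       = ⊥-elim (j≢c refl)
  punchIn-punchIn-comm n       zero    (suc c) j≢c l       = refl
  punchIn-punchIn-comm n       (suc j) zero    j≢c l       = refl
  punchIn-punchIn-comm (suc n) (suc j) (suc c) j≢c zero    = refl
  punchIn-punchIn-comm (suc n) (suc j) (suc c) j≢c (suc l) = cong suc (begin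
    punchIn j (punchIn (punchOut (j≢c ∘ cong suc)) l)
      ≡⟨ punchIn-punchIn-comm n j c (j≢c ∘ cong suc) l ⟩
    punchIn c (punchIn (punchOut ((j≢c ∘ cong suc) ∘ sym)) l)
      ≡⟨ cong (λ k → punchIn c (punchIn k l)) (punchOut-cong c refl) ⟩
    punchIn c (punchIn (punchOut ((j≢c ∘ sym) ∘ cong suc)) l) ∎)

  sign-punchOut-anticomm : ∀ n (j c : Fin (suc (suc n))) (j≢c : j ≢ c) →
                           sign (toℕ j) * sign (toℕ (punchOut j≢c))
                             ≡ - (sign (toℕ c) * sign (toℕ (punchOut (j≢c ∘ sym))))
  sign-punchOut-anticomm n       zero    zero    j≢c = ⊥-elim (j≢c refl)
  sign-punchOut-anticomm n       zero    (suc c) j≢c = flip (sign (toℕ c))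
    where
    flip : ∀ x → 1ℤ * x ≡ - ((- x) * 1ℤ)
    flip = solve-∀
  sign-punchOut-anticomm n       (suc j) zero    j≢c = flip (sign (toℕ j))
    where
    flip : ∀ x → (- x) * 1ℤ ≡ - (1ℤ * x)
    flip = solve-∀
  sign-punchOut-anticomm zero    (suc zero) (suc zero) j≢c = ⊥-elim (j≢c refl)
  sign-punchOut-anticomm (suc n) (suc j) (suc c) j≢c = begin
    (- sign (toℕ j)) * (- sign (toℕ (punchOut (j≢c ∘ cong suc))))
      ≡⟨ neg-neg (sign (toℕ j)) _ ⟩
    sign (toℕ j) * sign (toℕ (punchOut (j≢c ∘ cong suc)))
      ≡⟨ sign-punchOut-anticomm n j c (j≢c ∘ cong suc) ⟩
    - (sign (toℕ c) * sign (toℕ (punchOut ((j≢c ∘ cong suc) ∘ sym))))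
      ≡⟨ cong (λ k → - (sign (toℕ c) * sign (toℕ k))) (punchOut-cong c refl) ⟩
    - (sign (toℕ c) * sign (toℕ (punchOut ((j≢c ∘ sym) ∘ cong suc))))
      ≡⟨ cong -_ (sym (neg-neg (sign (toℕ c)) _)) ⟩
    - ((- sign (toℕ c)) * (- sign (toℕ (punchOut ((j≢c ∘ sym) ∘ cong suc))))) ∎
    where
    neg-neg : ∀ x y → (- x) * (- y) ≡ x * y
    neg-neg = solve-∀

  -- Expanding det A along its first two rows gives a sum over ordered pairs (j , c) of distinct
  -- columns; when these rows are equal the terms for (j , c) and (c , j) cancel.
  module EqualFirstTwoRows (n : ℕ) (A : Matrix (suc (suc n))) (A₁≗A₀ : ∀ j → A (suc zero) j ≡ A zero j) where

    D : Fin (suc (suc n)) → Fin (suc n) → ℤ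
    D j k = det (minor (minor A j) k)

    term : Fin (suc (suc n)) → Fin (suc n) → ℤ
    term j k = sign (toℕ j) * (A zero j * (sign (toℕ k) * (A (suc zero) (punchIn j k) * D j k)))

    pairTerm : Fin (suc (suc n)) → Fin (suc (suc n)) → ℤ
    pairTerm j c with c ≟ j
    ... | yes _   = 0ℤ
    ... | no  c≢j = term j (punchOut (c≢j ∘ sym))

    det-doubleExpansion : det A ≡ sumℤ (suc (suc n)) (λ j → sumℤ (suc n) (term j))
    det-doubleExpansion = sumℤ-cong (suc (suc n)) λ j → sym (begin
      sumℤ (suc n) (λ k → sign (toℕ j) * (A zero j * laplaceTerm (minor A j) k))
        ≡⟨ sumℤ-*ˡ (suc n) (sign (toℕ j)) (λ k → A zero j * laplaceTerm (minor A j) k) ⟩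
      sign (toℕ j) * sumℤ (suc n) (λ k → A zero j * laplaceTerm (minor A j) k)
        ≡⟨ cong (sign (toℕ j) *_) (sumℤ-*ˡ (suc n) (A zero j) (laplaceTerm (minor A j))) ⟩
      laplaceTerm A j ∎)

    sum-term≡sum-pairTerm : ∀ j → sumℤ (suc n) (term j) ≡ sumℤ (suc (suc n)) (pairTerm j)
    sum-term≡sum-pairTerm j = sym (begin
      sumℤ (suc (suc n)) (pairTerm j)
        ≡⟨ sumℤ-punchIn (suc n) j (pairTerm j) ⟩
      pairTerm j j + sumℤ (suc n) (pairTerm j ∘ punchIn j)
        ≡⟨ cong₂ _+_ diagonal (sumℤ-cong (suc n) offDiagonal) ⟩
      0ℤ + sumℤ (suc n) (term j)
        ≡⟨ +-identityˡ _ ⟩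
      sumℤ (suc n) (term j) ∎)
      where
      diagonal : pairTerm j j ≡ 0ℤ
      diagonal with j ≟ j
      ... | yes _  = refl
      ... | no j≢j = ⊥-elim (j≢j refl)
      offDiagonal : ∀ k → pairTerm j (punchIn j k) ≡ term j k
      offDiagonal k with punchIn j k ≟ j
      ... | yes p≡j = ⊥-elim (punchInᵢ≢i j k p≡j)
      ... | no  _   = cong (term j) (trans (punchOut-cong j refl) (punchOut-punchIn j))

    pairTerm-antisym : ∀ j c → pairTerm c j ≡ - pairTerm j c
    pairTerm-antisym j c with j ≟ c | c ≟ j
    ... | yes _   | yes _   = refl
    ... | yes j≡c | no c≢j  = ⊥-elim (c≢j (sym j≡c))
    ... | no j≢c  | yes c≡j = ⊥-elim (j≢c (sym c≡j))
    ... | no j≢c  | no c≢j  = begin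
      term c (punchOut (j≢c ∘ sym))
        ≡⟨ cong (term c) (punchOut-cong c refl) ⟩
      sign (toℕ c) * (A zero c * (sign (toℕ k′) * (A (suc zero) (punchIn c k′) * D c k′)))
        ≡⟨ cong₂ (λ a d → sign (toℕ c) * (A zero c * (sign (toℕ k′) * (a * d))))
                 (trans (cong (A (suc zero)) (punchIn-punchOut (e ∘ sym))) (A₁≗A₀ j))
                 (det-cong n (λ i l → cong (A (suc (suc i))) (sym (punchIn-punchIn-comm n j c e l)))) ⟩
      sign (toℕ c) * (A zero c * (sign (toℕ k′) * (A zero j * D j k)))
        ≡⟨ swapFactors (sign (toℕ j)) (sign (toℕ k)) (sign (toℕ c)) (sign (toℕ k′)) (A zero j) (A zero c) (D j k)
                       (sign-punchOut-anticomm n j c e) ⟩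
      - (sign (toℕ j) * (A zero j * (sign (toℕ k) * (A zero c * D j k))))
        ≡⟨ cong (λ a → - (sign (toℕ j) * (A zero j * (sign (toℕ k) * (a * D j k)))))
                (sym (trans (cong (A (suc zero)) (punchIn-punchOut e)) (A₁≗A₀ c))) ⟩
      - term j k ∎
      where
      e = c≢j ∘ sym
      k = punchOut e
      k′ = punchOut (e ∘ sym)
      swapFactors : ∀ sj sk sc sk′ aj ac d → sj * sk ≡ - (sc * sk′) →
                    sc * (ac * (sk′ * (aj * d))) ≡ - (sj * (aj * (sk * (ac * d))))
      swapFactors sj sk sc sk′ aj ac d eq = begin
        sc * (ac * (sk′ * (aj * d)))    ≡⟨ regroup₁ sc sk′ aj ac d ⟩
        - (- (sc * sk′) * (aj * (ac * d))) ≡⟨ cong (λ z → - (z * (aj * (ac * d)))) (sym eq) ⟩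
        - ((sj * sk) * (aj * (ac * d)))  ≡⟨ regroup₂ sj sk aj ac d ⟩
        - (sj * (aj * (sk * (ac * d)))) ∎
        where
        regroup₁ : ∀ sc sk′ aj ac d → sc * (ac * (sk′ * (aj * d))) ≡ - (- (sc * sk′) * (aj * (ac * d)))
        regroup₁ = solve-∀
        regroup₂ : ∀ sj sk aj ac d → - ((sj * sk) * (aj * (ac * d))) ≡ - (sj * (aj * (sk * (ac * d))))
        regroup₂ = solve-∀

    det≡0 : det A ≡ 0ℤ
    det≡0 = trans det-doubleExpansion (trans (sumℤ-cong N sum-term≡sum-pairTerm) (i≡-i⇒i≡0 S S≡-S))
      where
      N = suc (suc n)
      S = sumℤ N (λ j → sumℤ N (pairTerm j))
      S≡-S : S ≡ - S
      S≡-S = begin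
        S                                         ≡⟨ sumℤ-swap N N pairTerm ⟩
        sumℤ N (λ c → sumℤ N (λ j → pairTerm j c))   ≡⟨ sumℤ-cong N (λ c → sumℤ-cong N (λ j → pairTerm-antisym c j)) ⟩
        sumℤ N (λ c → sumℤ N (λ j → - pairTerm c j)) ≡⟨ sumℤ-cong N (λ c → sumℤ-neg N (pairTerm c)) ⟩
        sumℤ N (λ c → - sumℤ N (pairTerm c))         ≡⟨ sumℤ-neg N (λ c → sumℤ N (pairTerm c)) ⟩
        - S                                       ∎

  δ : ∀ {n} → Fin n → Fin n → ℤ
  δ i j with i ≟ j
  ... | yes _ = 1ℤ
  ... | no  _ = 0ℤ

  δ-≡ : ∀ {n} (i : Fin n) → δ i i ≡ 1ℤ
  δ-≡ i with i ≟ i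
  ... | yes _  = refl
  ... | no i≢i = ⊥-elim (i≢i refl)

  δ-≢ : ∀ {n} {i j : Fin n} → i ≢ j → δ i j ≡ 0ℤ
  δ-≢ {i = i} {j} i≢j with i ≟ j
  ... | yes i≡j = ⊥-elim (i≢j i≡j)
  ... | no  _   = refl

  δ-sym : ∀ {n} (i j : Fin n) → δ i j ≡ δ j i
  δ-sym i j = by-cases (i ≟ j)
    where
    by-cases : Dec (i ≡ j) → δ i j ≡ δ j i
    by-cases (yes refl) = refl
    by-cases (no  i≢j)  = trans (δ-≢ i≢j) (sym (δ-≢ (i≢j ∘ sym)))

  δ-suc : ∀ {n} (i j : Fin n) → δ (suc i) (suc j) ≡ δ i j
  δ-suc i j = by-cases (i ≟ j)
    where
    by-cases : Dec (i ≡ j) → δ (suc i) (suc j) ≡ δ i j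
    by-cases (yes refl) = trans (δ-≡ (suc i)) (sym (δ-≡ i))
    by-cases (no  i≢j)  = trans (δ-≢ (i≢j ∘ suc-injective)) (sym (δ-≢ i≢j))

  Id : ∀ n → Matrix n
  Id n = δ

  RowAlternating : ∀ {n} → (Matrix n → ℤ) → Set
  RowAlternating {n} f = ∀ (A : Matrix n) r s → r ≢ s → (∀ j → A r j ≡ A s j) → f A ≡ 0ℤ

  record IsAltMultilinear (n : ℕ) (f : Matrix n → ℤ) : Set where
    field
      f-cong      : ∀ {A B : Matrix n} → (∀ i j → A i j ≡ B i j) → f A ≡ f B
      rowLinear   : ∀ (r : Fin n) (A B C : Matrix n) (x y : ℤ) →
                    (∀ i j → i ≢ r → A i j ≡ B i j) → (∀ i j → i ≢ r → A i j ≡ C i j) →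
                    (∀ j → A r j ≡ x * B r j + y * C r j) → f A ≡ x * f B + y * f C
      alternating : RowAlternating f

  setRow : ∀ {n} → Matrix n → Fin n → (Fin n → ℤ) → Matrix n
  setRow A r u i with i ≟ r
  ... | yes _ = u
  ... | no  _ = A i

  setRow-≡ : ∀ {n} (A : Matrix n) r u {i} → i ≡ r → setRow A r u i ≡ u
  setRow-≡ A r u refl with r ≟ r
  ... | yes _  = refl
  ... | no r≢r = ⊥-elim (r≢r refl)

  setRow-≢ : ∀ {n} (A : Matrix n) r u {i} → i ≢ r → setRow A r u i ≡ A i
  setRow-≢ A r u {i} i≢r with i ≟ r
  ... | yes i≡r = ⊥-elim (i≢r i≡r)
  ... | no  _   = refl

  ≗setRow² : ∀ {n} (A : Matrix n) {a b} → a ≢ b → ∀ {u v} (R : Matrix n) → R a ≡ u → R b ≡ v →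
             (∀ {i} → i ≢ a → i ≢ b → R i ≡ A i) → ∀ i → R i ≡ setRow (setRow A a u) b v i
  ≗setRow² A {a} {b} a≢b {u} {v} R Ra≡u Rb≡v Ri≡Ai i = by-cases (i ≟ a) (i ≟ b)
    where
    by-cases : Dec (i ≡ a) → Dec (i ≡ b) → R i ≡ setRow (setRow A a u) b v i
    by-cases (yes refl) _          = trans Ra≡u (sym (trans (setRow-≢ _ b v a≢b) (setRow-≡ A i u refl)))
    by-cases (no  _)    (yes refl) = trans Rb≡v (sym (setRow-≡ _ i v refl))
    by-cases (no  i≢a)  (no  i≢b)  = trans (Ri≡Ai i≢a i≢b) (sym (trans (setRow-≢ _ b v i≢b) (setRow-≢ A a u i≢a)))

  setRow-comm : ∀ {n} (A : Matrix n) {a b} → a ≢ b → ∀ u v i →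
                setRow (setRow A a u) b v i ≡ setRow (setRow A b v) a u i
  setRow-comm A {a} {b} a≢b u v i = sym (≗setRow² A a≢b (setRow (setRow A b v) a u)
    (setRow-≡ _ a u refl)
    (trans (setRow-≢ _ a u (a≢b ∘ sym)) (setRow-≡ A b v refl))
    (λ i≢a i≢b → trans (setRow-≢ _ a u i≢a) (setRow-≢ A b v i≢b)) i)

  transpose-≡ˡ : ∀ {n} (a b : Fin n) {i} → i ≡ a → transpose a b i ≡ b
  transpose-≡ˡ a b refl rewrite dec-true (a ≟ a) refl = refl

  transpose-≡ʳ : ∀ {n} (a b : Fin n) {i} → i ≡ b → transpose a b i ≡ a
  transpose-≡ʳ a b refl with b ≟ a
  ... | yes b≡a = b≡a
  ... | no  _   rewrite dec-true (b ≟ b) refl = refl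

  transpose-≢ : ∀ {n} (a b : Fin n) {i} → i ≢ a → i ≢ b → transpose a b i ≡ i
  transpose-≢ a b {i} i≢a i≢b rewrite dec-false (i ≟ a) i≢a | dec-false (i ≟ b) i≢b = refl

  transpose-suc : ∀ {n} (a b i : Fin n) → transpose (suc a) (suc b) (suc i) ≡ suc (transpose a b i)
  transpose-suc a b i = by-cases (i ≟ a) (i ≟ b)
    where
    by-cases : Dec (i ≡ a) → Dec (i ≡ b) → transpose (suc a) (suc b) (suc i) ≡ suc (transpose a b i)
    by-cases (yes i≡a) _         = trans (transpose-≡ˡ (suc a) (suc b) (cong suc i≡a)) (cong suc (sym (transpose-≡ˡ a b i≡a)))
    by-cases (no  i≢a) (yes i≡b) = trans (transpose-≡ʳ (suc a) (suc b) (cong suc i≡b)) (cong suc (sym (transpose-≡ʳ a b i≡b)))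
    by-cases (no  i≢a) (no  i≢b) = trans (transpose-≢ (suc a) (suc b) (i≢a ∘ suc-injective) (i≢b ∘ suc-injective))
                                         (cong suc (sym (transpose-≢ a b i≢a i≢b)))

  module AltMultilinear {n} {f : Matrix n → ℤ} (isAlt : IsAltMultilinear n f) where
    open IsAltMultilinear isAlt

    setRow-linear : ∀ A r x y (u v w : Fin n → ℤ) → (∀ j → w j ≡ x * u j + y * v j) →
                    f (setRow A r w) ≡ x * f (setRow A r u) + y * f (setRow A r v)
    setRow-linear A r x y u v w w≗ = rowLinear r _ _ _ x y (unchanged u) (unchanged v) λ j → begin
      setRow A r w r j                            ≡⟨ cong-app (setRow-≡ A r w refl) j ⟩
      w j                                         ≡⟨ w≗ j ⟩
      x * u j + y * v j                           ≡⟨ sym (cong₂ (λ p q → x * p j + y * q j) (setRow-≡ A r u refl) (setRow-≡ A r v refl)) ⟩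
      x * setRow A r u r j + y * setRow A r v r j ∎
      where
      unchanged : ∀ u i j → i ≢ r → setRow A r w i j ≡ setRow A r u i j
      unchanged u i j i≢r = cong-app (trans (setRow-≢ A r w i≢r) (sym (setRow-≢ A r u i≢r))) j

    setRow-additive : ∀ A r (u v : Fin n → ℤ) →
                      f (setRow A r (λ j → u j + v j)) ≡ f (setRow A r u) + f (setRow A r v)
    setRow-additive A r u v =
      trans (setRow-linear A r 1ℤ 1ℤ u v _ (λ j → sym (cong₂ _+_ (*-identityˡ (u j)) (*-identityˡ (v j)))))
            (cong₂ _+_ (*-identityˡ (f (setRow A r u))) (*-identityˡ (f (setRow A r v))))

    setRow-self : ∀ A r → f (setRow A r (A r)) ≡ f A
    setRow-self A r = f-cong λ i → cong-app (by-cases i (i ≟ r))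
      where
      by-cases : ∀ i → Dec (i ≡ r) → setRow A r (A r) i ≡ A i
      by-cases i (yes i≡r) = trans (setRow-≡ A r (A r) i≡r) (cong A (sym i≡r))
      by-cases i (no  i≢r) = setRow-≢ A r (A r) i≢r

    setRow-sum : ∀ A r m (c : Fin m → ℤ) (V : Fin m → Fin n → ℤ) →
                 f (setRow A r (λ l → sumℤ m (λ k → c k * V k l))) ≡ sumℤ m (λ k → c k * f (setRow A r (V k)))
    setRow-sum A r zero    c V = setRow-linear A r 0ℤ 0ℤ (λ _ → 0ℤ) (λ _ → 0ℤ) _ (λ _ → refl)
    setRow-sum A r (suc m) c V =
      trans (setRow-linear A r (c zero) 1ℤ (V zero) rest _ (λ l → cong (c zero * V zero l +_) (sym (*-identityˡ (rest l)))))
            (cong (c zero * f (setRow A r (V zero)) +_)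
                  (trans (*-identityˡ _) (setRow-sum A r m (c ∘ suc) (V ∘ suc))))
      where
      rest : Fin n → ℤ
      rest l = sumℤ m (λ k → c (suc k) * V (suc k) l)

    expandRow : ∀ A r → f A ≡ sumℤ n (λ j → A r j * f (setRow A r (δ j)))
    expandRow A r = trans (f-cong λ i l → A≗ i l (i ≟ r)) (setRow-sum A r n (A r) δ)
      where
      Aᵣ-expansion : ∀ l → A r l ≡ sumℤ n (λ j → A r j * δ j l)
      Aᵣ-expansion l = sym (trans (sumℤ-single n l _ (λ j j≢l → trans (cong (A r j *_) (δ-≢ j≢l)) (*-zeroʳ (A r j))))
                                  (trans (cong (A r l *_) (δ-≡ l)) (*-identityʳ (A r l))))
      A≗ : ∀ i l → Dec (i ≡ r) → A i l ≡ setRow A r (λ l → sumℤ n (λ j → A r j * δ j l)) i l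
      A≗ i l (yes refl) = trans (Aᵣ-expansion l) (sym (cong-app (setRow-≡ A i _ refl) l))
      A≗ i l (no  i≢r)  = sym (cong-app (setRow-≢ A r _ i≢r) l)

    -- Expand f at the matrix whose rows a and b both equal u + v.
    setRow²-antisym : ∀ A {a b} → a ≢ b → ∀ u v →
                      f (setRow (setRow A a v) b u) + f (setRow (setRow A a u) b v) ≡ 0ℤ
    setRow²-antisym A {a} {b} a≢b u v = begin
      f (M v u) + f (M u v)
        ≡⟨ cancel (f (M u u)) (f (M u v)) (f (M v u)) (f (M v v)) (repeated u) (repeated v) ⟩
      (f (M u u) + f (M u v)) + (f (M v u) + f (M v v))
        ≡⟨ sym (cong₂ _+_ (setRow-additive (setRow A a u) b u v) (setRow-additive (setRow A a v) b u v)) ⟩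
      f (M u u+v) + f (M v u+v)
        ≡⟨ sym (additiveˡ u v u+v) ⟩
      f (M u+v u+v)
        ≡⟨ repeated u+v ⟩
      0ℤ ∎
      where
      u+v = λ j → u j + v j
      M : (w w′ : Fin n → ℤ) → Matrix n
      M w w′ = setRow (setRow A a w) b w′
      repeated : ∀ w → f (M w w) ≡ 0ℤ
      repeated w = alternating (M w w) a b a≢b
        (cong-app (trans (trans (setRow-≢ _ b w a≢b) (setRow-≡ A a w refl)) (sym (setRow-≡ _ b w refl))))
      additiveˡ : ∀ w w′ w″ → f (M (λ j → w j + w′ j) w″) ≡ f (M w w″) + f (M w′ w″)
      additiveˡ w w′ w″ = begin
        f (M (λ j → w j + w′ j) w″)                      ≡⟨ f-cong (λ i → cong-app (setRow-comm A a≢b _ w″ i)) ⟩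
        f (setRow (setRow A b w″) a (λ j → w j + w′ j))  ≡⟨ setRow-additive (setRow A b w″) a w w′ ⟩
        f (setRow (setRow A b w″) a w) + f (setRow (setRow A b w″) a w′)
          ≡⟨ sym (cong₂ _+_ (f-cong (λ i → cong-app (setRow-comm A a≢b w w″ i)))
                            (f-cong (λ i → cong-app (setRow-comm A a≢b w′ w″ i)))) ⟩
        f (M w w″) + f (M w′ w″) ∎
      cancel : ∀ p q r s → p ≡ 0ℤ → s ≡ 0ℤ → r + q ≡ (p + q) + (r + s)
      cancel _ q r _ refl refl = regroup q r
        where
        regroup : ∀ q r → r + q ≡ (0ℤ + q) + (r + 0ℤ)
        regroup = solve-∀

    swapRows-antisym : ∀ A {a b} → a ≢ b → f (λ i → A (transpose a b i)) ≡ - f A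
    swapRows-antisym A {a} {b} a≢b = i-j≡0⇒i≡j (f (A ∘ transpose a b)) (- f A) (begin
      f (A ∘ transpose a b) - - f A
        ≡⟨ cong (f (A ∘ transpose a b) +_) (neg-involutive (f A)) ⟩
      f (A ∘ transpose a b) + f A
        ≡⟨ cong₂ _+_ (f-cong λ i → cong-app (swapped i)) (f-cong λ i → cong-app (original i)) ⟩
      f (setRow (setRow A a (A b)) b (A a)) + f (setRow (setRow A a (A a)) b (A b))
        ≡⟨ setRow²-antisym A a≢b (A a) (A b) ⟩
      0ℤ ∎)
      where
      original : ∀ i → A i ≡ setRow (setRow A a (A a)) b (A b) i
      original = ≗setRow² A a≢b A refl refl (λ _ _ → refl)
      swapped : ∀ i → A (transpose a b i) ≡ setRow (setRow A a (A b)) b (A a) i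
      swapped = ≗setRow² A a≢b (A ∘ transpose a b) (cong A (transpose-≡ˡ a b refl)) (cong A (transpose-≡ʳ a b refl))
                  (λ i≢a i≢b → cong A (transpose-≢ a b i≢a i≢b))

  rowAlternating⇒det-isAltMultilinear : ∀ n → RowAlternating (det {n}) → IsAltMultilinear n det
  rowAlternating⇒det-isAltMultilinear n alt = record { f-cong = det-cong n ; rowLinear = det-rowLinear n ; alternating = alt }

  det-swapLowerRows : ∀ n → RowAlternating (det {suc n}) → (A : Matrix (suc (suc n))) → ∀ {a b} → a ≢ b →
                      det (λ i → A (transpose (suc a) (suc b) i)) ≡ - det A
  det-swapLowerRows n alt A {a} {b} a≢b =
    trans (sumℤ-cong (suc (suc n)) term) (sumℤ-neg (suc (suc n)) (laplaceTerm A))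
    where
    open AltMultilinear (rowAlternating⇒det-isAltMultilinear (suc n) alt)
    term : ∀ j → laplaceTerm (λ i → A (transpose (suc a) (suc b) i)) j ≡ - laplaceTerm A j
    term j = begin
      sign (toℕ j) * (A (transpose (suc a) (suc b) zero) j * det (λ i k → A (transpose (suc a) (suc b) (suc i)) (punchIn j k)))
        ≡⟨ cong₂ (λ x d → sign (toℕ j) * (A x j * d)) (transpose-≢ (suc a) (suc b) (λ ()) (λ ()))
                 (trans (det-cong (suc n) (λ i k → cong (λ x → A x (punchIn j k)) (transpose-suc a b i)))
                        (swapRows-antisym (minor A j) a≢b)) ⟩
      sign (toℕ j) * (A zero j * - det (minor A j))
        ≡⟨ pull-neg (sign (toℕ j)) (A zero j) (det (minor A j)) ⟩
      - laplaceTerm A j ∎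
      where
      pull-neg : ∀ s a d → s * (a * - d) ≡ - (s * (a * d))
      pull-neg = solve-∀

  det-firstRowRepeated : ∀ n → RowAlternating (det {suc n}) → (A : Matrix (suc (suc n))) →
                         ∀ s → (∀ j → A zero j ≡ A (suc s) j) → det A ≡ 0ℤ
  det-firstRowRepeated n alt A zero    A₀≗A₁ = EqualFirstTwoRows.det≡0 n A (sym ∘ A₀≗A₁)
  det-firstRowRepeated n alt A (suc s) A₀≗Aₛ = begin
    det A     ≡⟨ sym (neg-involutive (det A)) ⟩
    - - det A ≡⟨ cong -_ (sym (det-swapLowerRows n alt A {zero} {suc s} λ ())) ⟩
    - det A′  ≡⟨ cong -_ (EqualFirstTwoRows.det≡0 n A′ A′₁≗A′₀) ⟩
    0ℤ        ∎
    where
    A′ : Matrix (suc (suc n))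
    A′ i = A (transpose (suc zero) (suc (suc s)) i)
    A′₁≗A′₀ : ∀ j → A′ (suc zero) j ≡ A′ zero j
    A′₁≗A′₀ j = begin
      A′ (suc zero) j ≡⟨ cong (λ x → A x j) (transpose-≡ˡ (suc zero) (suc (suc s)) refl) ⟩
      A (suc (suc s)) j ≡⟨ sym (A₀≗Aₛ j) ⟩
      A zero j ≡⟨ cong (λ x → A x j) (sym (transpose-≢ (suc zero) (suc (suc s)) (λ ()) (λ ()))) ⟩
      A′ zero j ∎

  det-alternating : ∀ n → RowAlternating (det {n})
  det-alternating (suc n)       A zero    zero    0≢0 _     = ⊥-elim (0≢0 refl)
  det-alternating (suc zero)    A zero    (suc ())
  det-alternating (suc zero)    A (suc ())
  det-alternating (suc (suc n)) A zero    (suc s) _   A₀≗Aₛ =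
    det-firstRowRepeated n (det-alternating (suc n)) A s A₀≗Aₛ
  det-alternating (suc (suc n)) A (suc r) zero    _   Aᵣ≗A₀ =
    det-firstRowRepeated n (det-alternating (suc n)) A r (sym ∘ Aᵣ≗A₀)
  det-alternating (suc n)       A (suc r) (suc s) r≢s Aᵣ≗Aₛ = sumℤ-zero (suc n) λ j → begin
    sign (toℕ j) * (A zero j * det (minor A j))
      ≡⟨ cong (λ d → sign (toℕ j) * (A zero j * d))
              (det-alternating n (minor A j) r s (r≢s ∘ cong suc) (Aᵣ≗Aₛ ∘ punchIn j)) ⟩
    sign (toℕ j) * (A zero j * 0ℤ)
      ≡⟨ cong (sign (toℕ j) *_) (*-zeroʳ (A zero j)) ⟩
    sign (toℕ j) * 0ℤ
      ≡⟨ *-zeroʳ (sign (toℕ j)) ⟩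
    0ℤ ∎

  det-isAltMultilinear : ∀ n → IsAltMultilinear n det
  det-isAltMultilinear n = rowAlternating⇒det-isAltMultilinear n (det-alternating n)

  -- Uniqueness of alternating multilinear forms

  -- Adding a multiple of the first row e_j changes another row only in column j.
  module UnitFirstRow {n} {f : Matrix (suc n) → ℤ} (isAlt : IsAltMultilinear (suc n) f) (j : Fin (suc n)) where
    open IsAltMultilinear isAlt
    open AltMultilinear isAlt

    replaceRow : ∀ X → (∀ l → X zero l ≡ δ j l) → ∀ i w → (∀ l → l ≢ j → w l ≡ X (suc i) l) →
                 f (setRow X (suc i) w) ≡ f X
    replaceRow X X₀≗eⱼ i w w≈Xᵢ = begin
      f (setRow X (suc i) w)
        ≡⟨ setRow-linear X (suc i) 1ℤ y (X (suc i)) (X zero) w w≗ ⟩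
      1ℤ * f (setRow X (suc i) (X (suc i))) + y * f (setRow X (suc i) (X zero))
        ≡⟨ cong₂ (λ p q → 1ℤ * p + y * q) (setRow-self X (suc i)) repeated ⟩
      1ℤ * f X + y * 0ℤ
        ≡⟨ simplify (f X) y ⟩
      f X ∎
      where
      y = w j - X (suc i) j
      simplify : ∀ a y → 1ℤ * a + y * 0ℤ ≡ a
      simplify = solve-∀
      repeated : f (setRow X (suc i) (X zero)) ≡ 0ℤ
      repeated = alternating _ (suc i) zero (λ ()) λ l →
        trans (cong-app (setRow-≡ X (suc i) (X zero) refl) l) (sym (cong-app (setRow-≢ X (suc i) (X zero) λ ()) l))
      w≗ : ∀ l → w l ≡ 1ℤ * X (suc i) l + y * X zero l
      w≗ l = trans (by-cases (l ≟ j)) (cong (λ e → 1ℤ * X (suc i) l + y * e) (sym (X₀≗eⱼ l)))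
        where
        by-cases : Dec (l ≡ j) → w l ≡ 1ℤ * X (suc i) l + y * δ j l
        by-cases (yes refl) = trans (split (w l) (X (suc i) l)) (cong (λ e → 1ℤ * X (suc i) l + y * e) (sym (δ-≡ l)))
          where
          split : ∀ a b → a ≡ 1ℤ * b + (a - b) * 1ℤ
          split = solve-∀
        by-cases (no  l≢j)  = trans (w≈Xᵢ l l≢j) (trans (pad (X (suc i) l) y)
                                   (cong (λ e → 1ℤ * X (suc i) l + y * e) (sym (δ-≢ (l≢j ∘ sym)))))
          where
          pad : ∀ b y → b ≡ 1ℤ * b + y * 0ℤ
          pad = solve-∀

    replaceRows : ∀ m X Y → (∀ l → X zero l ≡ δ j l) → (∀ l → Y zero l ≡ X zero l) →
                  (∀ i l → l ≢ j → X (suc i) l ≡ Y (suc i) l) →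
                  (∀ i l → m ℕ.≤ toℕ i → X (suc i) l ≡ Y (suc i) l) → f X ≡ f Y
    replaceRows zero X Y _ Y₀≗X₀ _ agree = f-cong λ where
      zero    l → sym (Y₀≗X₀ l)
      (suc i) l → agree i l ℕ.z≤n
    replaceRows (suc m) X Y X₀≗eⱼ Y₀≗X₀ offⱼ agree with m ℕ.<? n
    ... | no  m≮n = replaceRows m X Y X₀≗eⱼ Y₀≗X₀ offⱼ λ i l m≤i → ⊥-elim (m≮n (ℕₚ.≤-<-trans m≤i (toℕ<n i)))
    ... | yes m<n = trans (sym (replaceRow X X₀≗eⱼ i₀ (Y (suc i₀)) λ l l≢j → sym (offⱼ i₀ l l≢j)))
                          (replaceRows m X′ Y X′₀≗eⱼ Y₀≗X′₀ offⱼ′ agree′)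
      where
      i₀ = fromℕ< m<n
      X′ = setRow X (suc i₀) (Y (suc i₀))
      X′₀≗X₀ : ∀ l → X′ zero l ≡ X zero l
      X′₀≗X₀ l = cong-app (setRow-≢ X (suc i₀) (Y (suc i₀)) λ ()) l
      X′₀≗eⱼ : ∀ l → X′ zero l ≡ δ j l
      X′₀≗eⱼ l = trans (X′₀≗X₀ l) (X₀≗eⱼ l)
      Y₀≗X′₀ : ∀ l → Y zero l ≡ X′ zero l
      Y₀≗X′₀ l = trans (Y₀≗X₀ l) (sym (X′₀≗X₀ l))
      X′≗Y-or : ∀ i l → (i ≢ i₀ → X (suc i) l ≡ Y (suc i) l) → X′ (suc i) l ≡ Y (suc i) l
      X′≗Y-or i l otherwise = by-cases (i ≟ i₀)
        where
        by-cases : Dec (i ≡ i₀) → X′ (suc i) l ≡ Y (suc i) l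
        by-cases (yes i≡i₀) = trans (cong-app (setRow-≡ X (suc i₀) (Y (suc i₀)) (cong suc i≡i₀)) l) (cong (λ k → Y (suc k) l) (sym i≡i₀))
        by-cases (no  i≢i₀) = trans (cong-app (setRow-≢ X (suc i₀) (Y (suc i₀)) (i≢i₀ ∘ suc-injective)) l) (otherwise i≢i₀)
      offⱼ′ : ∀ i l → l ≢ j → X′ (suc i) l ≡ Y (suc i) l
      offⱼ′ i l l≢j = X′≗Y-or i l λ _ → offⱼ i l l≢j
      agree′ : ∀ i l → m ℕ.≤ toℕ i → X′ (suc i) l ≡ Y (suc i) l
      agree′ i l m≤i = X′≗Y-or i l λ i≢i₀ →
        agree i l (ℕₚ.≤∧≢⇒< m≤i λ m≡i → i≢i₀ (toℕ-injective (trans (sym m≡i) (sym (toℕ-fromℕ< m<n)))))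

    unitFirstRow-cong : ∀ X Y → (∀ l → X zero l ≡ δ j l) → (∀ l → Y zero l ≡ X zero l) →
                        (∀ i l → l ≢ j → X (suc i) l ≡ Y (suc i) l) → f X ≡ f Y
    unitFirstRow-cong X Y X₀≗eⱼ Y₀≗X₀ offⱼ =
      replaceRows n X Y X₀≗eⱼ Y₀≗X₀ offⱼ λ i l n≤i → ⊥-elim (ℕₚ.<⇒≱ (toℕ<n i) n≤i)

  insertAt-cong : ∀ {n} (j : Fin (suc n)) {u v : Fin n → ℤ} → (∀ k → u k ≡ v k) →
                  ∀ l → insertAt u j 0ℤ l ≡ insertAt v j 0ℤ l
  insertAt-cong           zero    u≗v zero    = refl
  insertAt-cong           zero    u≗v (suc l) = u≗v l
  insertAt-cong {suc n}   (suc j) u≗v zero    = u≗v zero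
  insertAt-cong {suc n}   (suc j) u≗v (suc l) = insertAt-cong j (u≗v ∘ suc) l

  insertAt-linear : ∀ {n} (j : Fin (suc n)) x y (u v : Fin n → ℤ) l →
                    insertAt (λ k → x * u k + y * v k) j 0ℤ l ≡ x * insertAt u j 0ℤ l + y * insertAt v j 0ℤ l
  insertAt-linear         zero    x y u v zero    = zeros x y
    where
    zeros : ∀ x y → 0ℤ ≡ x * 0ℤ + y * 0ℤ
    zeros = solve-∀
  insertAt-linear         zero    x y u v (suc l) = refl
  insertAt-linear {suc n} (suc j) x y u v zero    = refl
  insertAt-linear {suc n} (suc j) x y u v (suc l) = insertAt-linear j x y (u ∘ suc) (v ∘ suc) l

  insertAt-punchOut : ∀ {n} (j : Fin (suc n)) (u : Fin (suc n) → ℤ) {l} → l ≢ j →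
                      insertAt (u ∘ punchIn j) j 0ℤ l ≡ u l
  insertAt-punchOut j u {l} l≢j = begin
    insertAt (u ∘ punchIn j) j 0ℤ l                         ≡⟨ cong (insertAt (u ∘ punchIn j) j 0ℤ) (sym l≡) ⟩
    insertAt (u ∘ punchIn j) j 0ℤ (punchIn j (punchOut j≢l)) ≡⟨ insertAt-punchIn (u ∘ punchIn j) j 0ℤ _ ⟩
    u (punchIn j (punchOut j≢l))                            ≡⟨ cong u l≡ ⟩
    u l ∎
    where
    j≢l = l≢j ∘ sym
    l≡ = punchIn-punchOut j≢l

  insertAt-δ : ∀ {n} (j : Fin (suc n)) (i : Fin n) l → insertAt (δ i) j 0ℤ l ≡ δ (punchIn j i) l
  insertAt-δ j i l with l ≟ j
  ... | yes refl = trans (insertAt-lookup (δ i) l 0ℤ) (sym (δ-≢ (punchInᵢ≢i l i)))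
  ... | no  l≢j  = begin
    insertAt (δ i) j 0ℤ l                         ≡⟨ cong (insertAt (δ i) j 0ℤ) (sym (punchIn-punchOut j≢l)) ⟩
    insertAt (δ i) j 0ℤ (punchIn j k)             ≡⟨ insertAt-punchIn (δ i) j 0ℤ k ⟩
    δ i k                                         ≡⟨ by-cases (i ≟ k) ⟩
    δ (punchIn j i) (punchIn j k)                 ≡⟨ cong (δ (punchIn j i)) (punchIn-punchOut j≢l) ⟩
    δ (punchIn j i) l ∎
    where
    j≢l = l≢j ∘ sym
    k = punchOut j≢l
    by-cases : Dec (i ≡ k) → δ i k ≡ δ (punchIn j i) (punchIn j k)
    by-cases (yes refl) = trans (δ-≡ i) (sym (δ-≡ (punchIn j i)))
    by-cases (no  i≢k)  = trans (δ-≢ i≢k) (sym (δ-≢ (i≢k ∘ punchIn-injective j i k)))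

  embed : ∀ {n} → Fin (suc n) → Matrix n → Matrix (suc n)
  embed j M zero    = δ j
  embed j M (suc i) = insertAt (M i) j 0ℤ

  embed-isAltMultilinear : ∀ {n} {f : Matrix (suc n) → ℤ} → IsAltMultilinear (suc n) f →
                           ∀ j → IsAltMultilinear n (f ∘ embed j)
  embed-isAltMultilinear isAlt j = record
    { f-cong      = λ M≗N → f-cong λ where
                      zero    l → refl
                      (suc i) l → insertAt-cong j (M≗N i) l
    ; rowLinear   = λ r M B C x y M≈B M≈C Mᵣ → rowLinear (suc r) (embed j M) (embed j B) (embed j C) x y
                      (lift M≈B) (lift M≈C) λ l → trans (insertAt-cong j Mᵣ l) (insertAt-linear j x y (B r) (C r) l)
    ; alternating = λ M r s r≢s Mᵣ≗Mₛ →
                      alternating (embed j M) (suc r) (suc s) (r≢s ∘ suc-injective) (insertAt-cong j Mᵣ≗Mₛ)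
    }
    where
    open IsAltMultilinear isAlt
    lift : ∀ {r M B} → (∀ i k → i ≢ r → M i k ≡ B i k) → ∀ i l → i ≢ suc r → embed j M i l ≡ embed j B i l
    lift M≈B zero    l _     = refl
    lift M≈B (suc i) l i≢sr = insertAt-cong j (λ k → M≈B i k (i≢sr ∘ cong suc)) l

  cycleMatrix : ∀ {n} → Fin (suc n) → Matrix (suc n)
  cycleMatrix c zero    = δ c
  cycleMatrix c (suc i) = δ (punchIn c i)

  punchIn-suc-self : ∀ {n} (j : Fin n) → punchIn (suc j) j ≡ inject₁ j
  punchIn-suc-self zero    = refl
  punchIn-suc-self (suc j) = cong suc (punchIn-suc-self j)

  punchIn-inject₁-self : ∀ {n} (j : Fin n) → punchIn (inject₁ j) j ≡ suc j
  punchIn-inject₁-self zero    = refl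
  punchIn-inject₁-self (suc j) = cong suc (punchIn-inject₁-self j)

  punchIn-inject₁ : ∀ {n} {i j : Fin n} → i ≢ j → punchIn (inject₁ j) i ≡ punchIn (suc j) i
  punchIn-inject₁ {i = zero}  {zero}  0≢0 = ⊥-elim (0≢0 refl)
  punchIn-inject₁ {i = suc i} {zero}  _   = refl
  punchIn-inject₁ {i = zero}  {suc j} _   = refl
  punchIn-inject₁ {i = suc i} {suc j} i≢j = cong suc (punchIn-inject₁ (i≢j ∘ cong suc))

  -- cycleMatrix c is the permutation matrix of a (toℕ c + 1)-cycle, reached by toℕ c row swaps.
  f-cycleMatrix : ∀ {n} {f : Matrix (suc n) → ℤ} → IsAltMultilinear (suc n) f →
                  ∀ c → f (cycleMatrix c) ≡ sign (toℕ c) * f (Id (suc n))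
  f-cycleMatrix {n} {f} isAlt c = go (toℕ c) c refl
    where
    open IsAltMultilinear isAlt
    open AltMultilinear isAlt
    go : ∀ m c → toℕ c ≡ m → f (cycleMatrix c) ≡ sign m * f (Id (suc n))
    go zero    zero    _   = trans (f-cong λ where zero l → refl ; (suc i) l → refl) (sym (*-identityˡ _))
    go (suc m) (suc j) c≡m = begin
      f (cycleMatrix (suc j))
        ≡⟨ sym (neg-involutive _) ⟩
      - - f (cycleMatrix (suc j))
        ≡⟨ cong -_ (sym (swapRows-antisym (cycleMatrix (suc j)) {zero} {suc j} λ ())) ⟩
      - f (λ i → cycleMatrix (suc j) (transpose zero (suc j) i))
        ≡⟨ cong -_ (f-cong λ i → cong-app (swapped i)) ⟩
      - f (cycleMatrix (inject₁ j))
        ≡⟨ cong -_ (go m (inject₁ j) (trans (toℕ-inject₁ j) (ℕₚ.suc-injective c≡m))) ⟩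
      - (sign m * f (Id (suc n)))
        ≡⟨ neg-distribˡ-* (sign m) (f (Id (suc n))) ⟩
      sign (suc m) * f (Id (suc n)) ∎
      where
      swapped : ∀ i → cycleMatrix (suc j) (transpose zero (suc j) i) ≡ cycleMatrix (inject₁ j) i
      swapped zero    = trans (cong (cycleMatrix (suc j)) (transpose-≡ˡ zero (suc j) refl))
                              (cong δ (punchIn-suc-self j))
      swapped (suc i) = by-cases (i ≟ j)
        where
        by-cases : Dec (i ≡ j) → cycleMatrix (suc j) (transpose zero (suc j) (suc i)) ≡ cycleMatrix (inject₁ j) (suc i)
        by-cases (yes refl) = trans (cong (cycleMatrix (suc i)) (transpose-≡ʳ zero (suc i) refl))
                                    (cong δ (sym (punchIn-inject₁-self i)))
        by-cases (no  i≢j)  = trans (cong (cycleMatrix (suc j)) (transpose-≢ zero (suc j) (λ ()) (i≢j ∘ suc-injective)))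
                                    (cong δ (sym (punchIn-inject₁ i≢j)))

  det-unique : ∀ n {f : Matrix n → ℤ} → IsAltMultilinear n f → ∀ A → f A ≡ det A * f (Id n)
  det-unique zero    isAlt A = trans (IsAltMultilinear.f-cong isAlt λ ()) (sym (*-identityˡ _))
  det-unique (suc n) {f} isAlt A = begin
    f A
      ≡⟨ expandRow A zero ⟩
    sumℤ (suc n) (λ j → A zero j * f (setRow A zero (δ j)))
      ≡⟨ sumℤ-cong (suc n) (λ j → cong (A zero j *_) (unitRow j)) ⟩
    sumℤ (suc n) (λ j → A zero j * (det (minor A j) * (sign (toℕ j) * f (Id (suc n)))))
      ≡⟨ sumℤ-cong (suc n) (λ j → regroup (A zero j) (det (minor A j)) (sign (toℕ j)) (f (Id (suc n)))) ⟩
    sumℤ (suc n) (λ j → laplaceTerm A j * f (Id (suc n)))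
      ≡⟨ sumℤ-*ʳ (suc n) (f (Id (suc n))) (laplaceTerm A) ⟩
    det A * f (Id (suc n)) ∎
    where
    open AltMultilinear isAlt
    regroup : ∀ a d s x → a * (d * (s * x)) ≡ (s * (a * d)) * x
    regroup = solve-∀
    unitRow : ∀ j → f (setRow A zero (δ j)) ≡ det (minor A j) * (sign (toℕ j) * f (Id (suc n)))
    unitRow j = begin
      f (setRow A zero (δ j))
        ≡⟨ UnitFirstRow.unitFirstRow-cong isAlt j (setRow A zero (δ j)) (embed j (minor A j))
             (cong-app (setRow-≡ A zero (δ j) refl)) (λ l → sym (cong-app (setRow-≡ A zero (δ j) refl) l))
             (λ i l l≢j → trans (cong-app (setRow-≢ A zero (δ j) λ ()) l) (sym (insertAt-punchOut j (A (suc i)) l≢j))) ⟩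
      f (embed j (minor A j))
        ≡⟨ det-unique n (embed-isAltMultilinear isAlt j) (minor A j) ⟩
      det (minor A j) * f (embed j (Id n))
        ≡⟨ cong (det (minor A j) *_) (IsAltMultilinear.f-cong isAlt λ where
             zero    l → refl
             (suc i) l → insertAt-δ j i l) ⟩
      det (minor A j) * f (cycleMatrix j)
        ≡⟨ cong (det (minor A j) *_) (f-cycleMatrix isAlt j) ⟩
      det (minor A j) * (sign (toℕ j) * f (Id (suc n))) ∎

  mul : ∀ {n} → Matrix n → Matrix n → Matrix n
  mul {n} A B i l = sumℤ n (λ k → A i k * B k l)

  _ᵀ : ∀ {n} → Matrix n → Matrix n
  (A ᵀ) i j = A j i

  mul-identityˡ : ∀ {n} (B : Matrix n) i l → mul (Id n) B i l ≡ B i l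
  mul-identityˡ {n} B i l = begin
    sumℤ n (λ k → δ i k * B k l) ≡⟨ sumℤ-single n i _ (λ k k≢i → trans (cong (_* B k l) (δ-≢ (k≢i ∘ sym))) (*-zeroˡ (B k l))) ⟩
    δ i i * B i l                ≡⟨ cong (_* B i l) (δ-≡ i) ⟩
    1ℤ * B i l                   ≡⟨ *-identityˡ (B i l) ⟩
    B i l ∎

  det-mul : ∀ n (A B : Matrix n) → det (mul A B) ≡ det A * det B
  det-mul n A B = trans (det-unique n mulʳ-isAltMultilinear A) (cong (det A *_) (det-cong n (mul-identityˡ B)))
    where
    open IsAltMultilinear (det-isAltMultilinear n)
    distribʳ : ∀ x y a b c → (x * a + y * b) * c ≡ x * (a * c) + y * (b * c)
    distribʳ = solve-∀
    mulʳ-isAltMultilinear : IsAltMultilinear n (λ X → det (mul X B))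
    mulʳ-isAltMultilinear = record
      { f-cong      = λ X≗Y → f-cong λ i l → sumℤ-cong n λ k → cong (_* B k l) (X≗Y i k)
      ; rowLinear   = λ r X Y Z x y X≈Y X≈Z Xᵣ → rowLinear r (mul X B) (mul Y B) (mul Z B) x y
          (λ i l i≢r → sumℤ-cong n λ k → cong (_* B k l) (X≈Y i k i≢r))
          (λ i l i≢r → sumℤ-cong n λ k → cong (_* B k l) (X≈Z i k i≢r))
          (λ l → trans (sumℤ-cong n λ k → trans (cong (_* B k l) (Xᵣ k)) (distribʳ x y (Y r k) (Z r k) (B k l)))
                       (sumℤ-linear n x y (λ k → Y r k * B k l) (λ k → Z r k * B k l)))
      ; alternating = λ X r s r≢s Xᵣ≗Xₛ → alternating (mul X B) r s r≢s λ l → sumℤ-cong n λ k → cong (_* B k l) (Xᵣ≗Xₛ k)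
      }

  det-Id : ∀ n → det (Id n) ≡ 1ℤ
  det-Id zero    = refl
  det-Id (suc n) = begin
    det (Id (suc n))                                   ≡⟨ det-firstRowPivot n (Id (suc n)) (λ j j≢0 → δ-≢ (j≢0 ∘ sym)) ⟩
    δ {suc n} zero zero * det (minor (Id (suc n)) zero) ≡⟨ cong₂ _*_ (δ-≡ {suc n} zero) (det-cong n δ-suc) ⟩
    1ℤ * det (Id n)                                    ≡⟨ *-identityˡ (det (Id n)) ⟩
    det (Id n)                                         ≡⟨ det-Id n ⟩
    1ℤ ∎

  det-colLinear : ∀ n (c : Fin n) (A B C : Matrix n) (x y : ℤ) →
                  (∀ i l → l ≢ c → A i l ≡ B i l) → (∀ i l → l ≢ c → A i l ≡ C i l) →
                  (∀ i → A i c ≡ x * B i c + y * C i c) → det A ≡ x * det B + y * det C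
  det-colLinear (suc n) c A B C x y A≈B A≈C Aᶜ =
    trans (sumℤ-cong (suc n) λ l → term l (l ≟ c)) (sumℤ-linear (suc n) x y (laplaceTerm B) (laplaceTerm C))
    where
    term : ∀ l → Dec (l ≡ c) → laplaceTerm A l ≡ x * laplaceTerm B l + y * laplaceTerm C l
    term l (yes refl) = begin
      s * (A zero l * det (minor A l))
        ≡⟨ cong (λ a → s * (a * det (minor A l))) (Aᶜ zero) ⟩
      s * ((x * B zero l + y * C zero l) * det (minor A l))
        ≡⟨ distrib s x y (B zero l) (C zero l) (det (minor A l)) ⟩
      x * (s * (B zero l * det (minor A l))) + y * (s * (C zero l * det (minor A l)))
        ≡⟨ cong₂ (λ d d′ → x * (s * (B zero l * d)) + y * (s * (C zero l * d′)))
                 (det-cong n λ i k → A≈B (suc i) (punchIn l k) (punchInᵢ≢i l k))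
                 (det-cong n λ i k → A≈C (suc i) (punchIn l k) (punchInᵢ≢i l k)) ⟩
      x * laplaceTerm B l + y * laplaceTerm C l ∎
      where
      s = sign (toℕ l)
      distrib : ∀ s x y b c d → s * ((x * b + y * c) * d) ≡ x * (s * (b * d)) + y * (s * (c * d))
      distrib = solve-∀
    term l (no l≢c) = begin
      s * (A zero l * det (minor A l))
        ≡⟨ cong (λ d → s * (A zero l * d))
                (det-colLinear n c′ (minor A l) (minor B l) (minor C l) x y
                   (λ i k k≢c′ → A≈B (suc i) (punchIn l k) (avoids k k≢c′))
                   (λ i k k≢c′ → A≈C (suc i) (punchIn l k) (avoids k k≢c′))
                   (λ i → subst (λ z → A (suc i) z ≡ x * B (suc i) z + y * C (suc i) z)
                                (sym (punchIn-punchOut l≢c)) (Aᶜ (suc i)))) ⟩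
      s * (A zero l * (x * det (minor B l) + y * det (minor C l)))
        ≡⟨ distrib s x y (A zero l) (det (minor B l)) (det (minor C l)) ⟩
      x * (s * (A zero l * det (minor B l))) + y * (s * (A zero l * det (minor C l)))
        ≡⟨ cong₂ (λ b c → x * (s * (b * det (minor B l))) + y * (s * (c * det (minor C l))))
                 (A≈B zero l l≢c) (A≈C zero l l≢c) ⟩
      x * laplaceTerm B l + y * laplaceTerm C l ∎
      where
      s = sign (toℕ l)
      c′ = punchOut l≢c
      avoids : ∀ k → k ≢ c′ → punchIn l k ≢ c
      avoids k k≢c′ e = k≢c′ (punchIn-injective l k c′ (trans e (sym (punchIn-punchOut l≢c))))
      distrib : ∀ s x y a d e → s * (a * (x * d + y * e)) ≡ x * (s * (a * d)) + y * (s * (a * e))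
      distrib = solve-∀

  transpose-involutive : ∀ {n} (a b i : Fin n) → transpose a b (transpose a b i) ≡ i
  transpose-involutive a b i = by-cases (i ≟ a) (i ≟ b)
    where
    by-cases : Dec (i ≡ a) → Dec (i ≡ b) → transpose a b (transpose a b i) ≡ i
    by-cases (yes refl) _          = trans (cong (transpose i b) (transpose-≡ˡ i b refl)) (transpose-≡ʳ i b refl)
    by-cases (no  _)    (yes refl) = trans (cong (transpose a i) (transpose-≡ʳ a i refl)) (transpose-≡ˡ a i refl)
    by-cases (no  i≢a)  (no  i≢b)  = trans (cong (transpose a b) (transpose-≢ a b i≢a i≢b)) (transpose-≢ a b i≢a i≢b)

  -- Swapping the equal columns c and d is right multiplication by a matrix of determinant -1.
  det-colAlternating : ∀ n (A : Matrix n) c d → c ≢ d → (∀ i → A i c ≡ A i d) → det A ≡ 0ℤ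
  det-colAlternating n A c d c≢d Aᶜ≗Aᵈ = i≡-i⇒i≡0 (det A) (begin
    det A           ≡⟨ det-cong n (λ i l → sym (mul-swap≗A i l)) ⟩
    det (mul A P)   ≡⟨ det-mul n A P ⟩
    det A * det P   ≡⟨ cong (det A *_) det-P ⟩
    det A * -1ℤ     ≡⟨ *-comm (det A) -1ℤ ⟩
    -1ℤ * det A     ≡⟨ -1*i≡-i (det A) ⟩
    - det A ∎)
    where
    τ = transpose c d
    P : Matrix n
    P k l = δ (τ k) l
    det-P : det P ≡ -1ℤ
    det-P = trans (AltMultilinear.swapRows-antisym (det-isAltMultilinear n) (Id n) c≢d) (cong -_ (det-Id n))
    column : ∀ i l → A i (τ l) ≡ A i l
    column i l = by-cases (l ≟ c) (l ≟ d)
      where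
      by-cases : Dec (l ≡ c) → Dec (l ≡ d) → A i (τ l) ≡ A i l
      by-cases (yes refl) _          = trans (cong (A i) (transpose-≡ˡ l d refl)) (sym (Aᶜ≗Aᵈ i))
      by-cases (no  _)    (yes refl) = trans (cong (A i) (transpose-≡ʳ c l refl)) (Aᶜ≗Aᵈ i)
      by-cases (no  l≢c)  (no  l≢d)  = cong (A i) (transpose-≢ c d l≢c l≢d)
    τ-flip : ∀ k {l} → τ k ≡ l → k ≡ τ l
    τ-flip k τk≡l = trans (sym (transpose-involutive c d k)) (cong τ τk≡l)
    mul-swap≗A : ∀ i l → mul A P i l ≡ A i l
    mul-swap≗A i l = begin
      sumℤ n (λ k → A i k * δ (τ k) l)
        ≡⟨ sumℤ-single n (τ l) _ (λ k k≢τl → trans (cong (A i k *_) (δ-≢ (k≢τl ∘ τ-flip k))) (*-zeroʳ (A i k))) ⟩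
      A i (τ l) * δ (τ (τ l)) l
        ≡⟨ cong (A i (τ l) *_) (trans (cong (λ k → δ k l) (transpose-involutive c d l)) (δ-≡ l)) ⟩
      A i (τ l) * 1ℤ
        ≡⟨ *-identityʳ _ ⟩
      A i (τ l)
        ≡⟨ column i l ⟩
      A i l ∎

  det-ᵀ : ∀ n (A : Matrix n) → det (A ᵀ) ≡ det A
  det-ᵀ n A = begin
    det (A ᵀ)               ≡⟨ det-unique n ᵀ-isAltMultilinear A ⟩
    det A * det (Id n ᵀ)    ≡⟨ cong (det A *_) (trans (det-cong n (λ i j → δ-sym j i)) (det-Id n)) ⟩
    det A * 1ℤ              ≡⟨ *-identityʳ (det A) ⟩
    det A ∎
    where
    ᵀ-isAltMultilinear : IsAltMultilinear n (λ X → det (X ᵀ))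
    ᵀ-isAltMultilinear = record
      { f-cong      = λ X≗Y → det-cong n λ i j → X≗Y j i
      ; rowLinear   = λ r X Y Z x y X≈Y X≈Z Xᵣ →
                        det-colLinear n r (X ᵀ) (Y ᵀ) (Z ᵀ) x y (λ i l → X≈Y l i) (λ i l → X≈Z l i) Xᵣ
      ; alternating = λ X r s → det-colAlternating n (X ᵀ) r s
      }

module Hadamard where

  open Determinant
  open import Data.Nat as ℕ using (ℕ; zero; suc)
  open import Data.Integer as ℤ using (ℤ; +_; +[1+_]; -[1+_]; _+_; _*_; -_; _^_; 0ℤ; 1ℤ; _≤_; _<_; +≤+; +<+)
  open import Data.Integer.Properties hiding (_≟_)
  open import Data.Integer.Tactic.RingSolver using (solve-∀)
  open import Data.Fin using (Fin; zero; suc)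
  open import Data.Sum using (inj₁; inj₂)
  open import Data.Empty using (⊥-elim)
  open import Relation.Nullary using (Dec; yes; no)
  open import Relation.Binary.PropositionalEquality
  open import Function using (_∘_)

  dot : ∀ {N} → (Fin N → ℤ) → (Fin N → ℤ) → ℤ
  dot {N} u v = sumℤ N (λ l → u l * v l)

  norm² : ∀ {N} → (Fin N → ℤ) → ℤ
  norm² u = dot u u

  gram : ∀ {m N} → (Fin m → Fin N → ℤ) → Matrix m
  gram B i j = dot (B i) (B j)

  prodℤ : ∀ m → (Fin m → ℤ) → ℤ
  prodℤ zero    f = 1ℤ
  prodℤ (suc m) f = f zero * prodℤ m (f ∘ suc)

  i*i≡∣i∣*∣i∣ : ∀ i → i * i ≡ + (ℤ.∣ i ∣ ℕ.* ℤ.∣ i ∣)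
  i*i≡∣i∣*∣i∣ (+ zero)   = refl
  i*i≡∣i∣*∣i∣ +[1+ n ]   = refl
  i*i≡∣i∣*∣i∣ -[1+ n ]   = refl

  i*i-nonNeg : ∀ i → 0ℤ ≤ i * i
  i*i-nonNeg i rewrite i*i≡∣i∣*∣i∣ i = +≤+ ℕ.z≤n

  i*i≡0⇒i≡0 : ∀ i → i * i ≡ 0ℤ → i ≡ 0ℤ
  i*i≡0⇒i≡0 i i*i≡0 with i*j≡0⇒i≡0∨j≡0 i i*i≡0
  ... | inj₁ i≡0 = i≡0
  ... | inj₂ i≡0 = i≡0

  sumℤ-nonNeg : ∀ n (f : Fin n → ℤ) → (∀ i → 0ℤ ≤ f i) → 0ℤ ≤ sumℤ n f
  sumℤ-nonNeg zero    f f≥0 = ≤-refl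
  sumℤ-nonNeg (suc n) f f≥0 = +-mono-≤ (f≥0 zero) (sumℤ-nonNeg n (f ∘ suc) (f≥0 ∘ suc))

  sumℤ-nonNeg-≡0 : ∀ n (f : Fin n → ℤ) → (∀ i → 0ℤ ≤ f i) → sumℤ n f ≡ 0ℤ → ∀ i → f i ≡ 0ℤ
  sumℤ-nonNeg-≡0 (suc n) f f≥0 Σf≡0 zero = ≤-antisym (begin
    f zero                    ≡⟨ sym (+-identityʳ (f zero)) ⟩
    f zero + 0ℤ               ≤⟨ +-monoʳ-≤ (f zero) (sumℤ-nonNeg n (f ∘ suc) (f≥0 ∘ suc)) ⟩
    f zero + sumℤ n (f ∘ suc) ≡⟨ Σf≡0 ⟩
    0ℤ                        ∎) (f≥0 zero)
    where open ≤-Reasoning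
  sumℤ-nonNeg-≡0 (suc n) f f≥0 Σf≡0 (suc i) = sumℤ-nonNeg-≡0 n (f ∘ suc) (f≥0 ∘ suc) Σtail≡0 i
    where
    open ≤-Reasoning
    Σtail≡0 : sumℤ n (f ∘ suc) ≡ 0ℤ
    Σtail≡0 = ≤-antisym (begin
      sumℤ n (f ∘ suc)           ≡⟨ sym (+-identityˡ _) ⟩
      0ℤ + sumℤ n (f ∘ suc)      ≤⟨ +-monoˡ-≤ (sumℤ n (f ∘ suc)) (f≥0 zero) ⟩
      f zero + sumℤ n (f ∘ suc)  ≡⟨ Σf≡0 ⟩
      0ℤ                         ∎) (sumℤ-nonNeg n (f ∘ suc) (f≥0 ∘ suc))

  norm²-nonNeg : ∀ {N} (u : Fin N → ℤ) → 0ℤ ≤ norm² u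
  norm²-nonNeg {N} u = sumℤ-nonNeg N _ (λ l → i*i-nonNeg (u l))

  norm²≡0⇒≡0 : ∀ {N} (u : Fin N → ℤ) → norm² u ≡ 0ℤ → ∀ l → u l ≡ 0ℤ
  norm²≡0⇒≡0 {N} u ‖u‖≡0 l = i*i≡0⇒i≡0 (u l) (sumℤ-nonNeg-≡0 N _ (λ l → i*i-nonNeg (u l)) ‖u‖≡0 l)

  dot-comm : ∀ {N} (u v : Fin N → ℤ) → dot u v ≡ dot v u
  dot-comm {N} u v = sumℤ-cong N (λ l → *-comm (u l) (v l))

  dot-cong : ∀ {N} {u u′ v v′ : Fin N → ℤ} → (∀ l → u l ≡ u′ l) → (∀ l → v l ≡ v′ l) → dot u v ≡ dot u′ v′
  dot-cong {N} u≗u′ v≗v′ = sumℤ-cong N (λ l → cong₂ _*_ (u≗u′ l) (v≗v′ l))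

  dot-linearʳ : ∀ {N} (u v w : Fin N → ℤ) x y → dot u (λ l → x * v l + y * w l) ≡ x * dot u v + y * dot u w
  dot-linearʳ {N} u v w x y = trans (sumℤ-cong N (λ l → distrib (u l) (v l) (w l) x y)) (sumℤ-linear N x y _ _)
    where
    distrib : ∀ a b c x y → a * (x * b + y * c) ≡ x * (a * b) + y * (a * c)
    distrib = solve-∀

  dot-linearˡ : ∀ {N} (u v w : Fin N → ℤ) x y → dot (λ l → x * v l + y * w l) u ≡ x * dot v u + y * dot w u
  dot-linearˡ u v w x y = begin
    dot (λ l → x * v l + y * w l) u ≡⟨ dot-comm _ u ⟩
    dot u (λ l → x * v l + y * w l) ≡⟨ dot-linearʳ u v w x y ⟩
    x * dot u v + y * dot u w       ≡⟨ cong₂ (λ p q → x * p + y * q) (dot-comm u v) (dot-comm u w) ⟩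
    x * dot v u + y * dot w u       ∎
    where open ≡-Reasoning

  *-nonNeg : ∀ {a b} → 0ℤ ≤ a → 0ℤ ≤ b → 0ℤ ≤ a * b
  *-nonNeg {+ a} {+ b} _ _ rewrite sym (pos-* a b) = +≤+ ℕ.z≤n

  *-monoˡ-≤-nonNeg′ : ∀ {a b c} → 0ℤ ≤ a → b ≤ c → a * b ≤ a * c
  *-monoˡ-≤-nonNeg′ {a} a≥0 = *-monoˡ-≤-nonNeg a {{ℤ.nonNegative a≥0}}

  *-pos : ∀ {a b} → 0ℤ < a → 0ℤ < b → 0ℤ < a * b
  *-pos {+[1+ a ]} {+[1+ b ]} _         _         = +<+ (ℕ.s≤s ℕ.z≤n)
  *-pos {+ zero}              (+<+ ()) _
  *-pos {+[1+ a ]} {+ zero}   _         (+<+ ())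

  ^-pos : ∀ {a} m → 0ℤ < a → 0ℤ < a ^ m
  ^-pos zero    _   = +<+ (ℕ.s≤s ℕ.z≤n)
  ^-pos (suc m) a>0 = *-pos a>0 (^-pos m a>0)

  *-cancelˡ-≤-pos′ : ∀ {k a b} → 0ℤ < k → k * a ≤ k * b → a ≤ b
  *-cancelˡ-≤-pos′ {k} {a} {b} k>0 = *-cancelˡ-≤-pos a b k {{ℤ.positive k>0}}

  prodℤ-nonNeg : ∀ m (f : Fin m → ℤ) → (∀ i → 0ℤ ≤ f i) → 0ℤ ≤ prodℤ m f
  prodℤ-nonNeg zero    f f≥0 = +≤+ ℕ.z≤n
  prodℤ-nonNeg (suc m) f f≥0 = *-nonNeg (f≥0 zero) (prodℤ-nonNeg m (f ∘ suc) (f≥0 ∘ suc))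

  prodℤ-mono-≤ : ∀ m (f g : Fin m → ℤ) → (∀ i → 0ℤ ≤ f i) → (∀ i → f i ≤ g i) → prodℤ m f ≤ prodℤ m g
  prodℤ-mono-≤ zero    f g f≥0 f≤g = ≤-refl
  prodℤ-mono-≤ (suc m) f g f≥0 f≤g = begin
    f zero * prodℤ m (f ∘ suc) ≤⟨ *-monoˡ-≤-nonNeg′ (f≥0 zero) (prodℤ-mono-≤ m (f ∘ suc) (g ∘ suc) (f≥0 ∘ suc) (f≤g ∘ suc)) ⟩
    f zero * prodℤ m (g ∘ suc) ≡⟨ *-comm (f zero) _ ⟩
    prodℤ m (g ∘ suc) * f zero ≤⟨ *-monoˡ-≤-nonNeg′ (prodℤ-nonNeg m (g ∘ suc) (λ i → ≤-trans (f≥0 (suc i)) (f≤g (suc i)))) (f≤g zero) ⟩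
    prodℤ m (g ∘ suc) * g zero ≡⟨ *-comm _ (g zero) ⟩
    g zero * prodℤ m (g ∘ suc) ∎
    where open ≤-Reasoning

  prodℤ-scale : ∀ m c (f : Fin m → ℤ) → prodℤ m (λ i → c * f i) ≡ c ^ m * prodℤ m f
  prodℤ-scale zero    c f = refl
  prodℤ-scale (suc m) c f =
    trans (cong (c * f zero *_) (prodℤ-scale m c (f ∘ suc))) (regroup c (f zero) (c ^ m) (prodℤ m (f ∘ suc)))
    where
    regroup : ∀ c a p q → (c * a) * (p * q) ≡ (c * p) * (a * q)
    regroup = solve-∀

  ^-square : ∀ a m → (a * a) ^ m ≡ a ^ m * a ^ m
  ^-square a zero    = refl
  ^-square a (suc m) = trans (cong (a * a *_) (^-square a m)) (regroup a (a ^ m))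
    where
    regroup : ∀ a k → (a * a) * (k * k) ≡ (a * k) * (a * k)
    regroup = solve-∀

  det-scalar : ∀ n c → det (λ (i k : Fin n) → c * δ i k) ≡ c ^ n
  det-scalar zero    c = refl
  det-scalar (suc n) c = begin
    det {suc n} (λ i k → c * δ i k)
      ≡⟨ det-firstRowPivot n (λ i k → c * δ i k) (λ j j≢0 → trans (cong (c *_) (δ-≢ (j≢0 ∘ sym))) (*-zeroʳ c)) ⟩
    c * δ {suc n} zero zero * det {n} (λ i k → c * δ (suc i) (suc k))
      ≡⟨ cong₂ _*_ (trans (cong (c *_) (δ-≡ {suc n} zero)) (*-identityʳ c))
                   (trans (det-cong n (λ i k → cong (c *_) (δ-suc i k))) (det-scalar n c)) ⟩
    c * c ^ n ∎
    where open ≡-Reasoning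

  -- Gram determinants

  combineRows : ∀ {m N} → Matrix m → (Fin m → Fin N → ℤ) → Fin m → Fin N → ℤ
  combineRows {m} E B a l = sumℤ m (λ c → E a c * B c l)

  gram-combineRows : ∀ {m N} (E : Matrix m) (B : Fin m → Fin N → ℤ) a b →
                     gram (combineRows E B) a b ≡ mul E (mul (gram B) (E ᵀ)) a b
  gram-combineRows {m} {N} E B a b = begin
    sumℤ N (λ l → sumℤ m (λ c → E a c * B c l) * sumℤ m (λ d → E b d * B d l))
      ≡⟨ sumℤ-cong N (λ l → trans (sym (sumℤ-*ʳ m _ (λ c → E a c * B c l)))
                                   (sumℤ-cong m λ c → sym (sumℤ-*ˡ m (E a c * B c l) (λ d → E b d * B d l)))) ⟩
    sumℤ N (λ l → sumℤ m (λ c → sumℤ m (λ d → T c d l)))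
      ≡⟨ sumℤ-swap N m (λ l c → sumℤ m (λ d → T c d l)) ⟩
    sumℤ m (λ c → sumℤ N (λ l → sumℤ m (λ d → T c d l)))
      ≡⟨ sumℤ-cong m (λ c → sumℤ-swap N m (λ l d → T c d l)) ⟩
    sumℤ m (λ c → sumℤ m (λ d → sumℤ N (T c d)))
      ≡⟨ sumℤ-cong m (λ c → sumℤ-cong m λ d → sumℤ-cong N λ l → regroup (E a c) (B c l) (B d l) (E b d)) ⟩
    sumℤ m (λ c → sumℤ m (λ d → sumℤ N (λ l → E a c * ((B c l * B d l) * E b d))))
      ≡⟨ sumℤ-cong m (λ c → trans (sumℤ-cong m λ d → trans (sumℤ-*ˡ N (E a c) _)
                                                             (cong (E a c *_) (sumℤ-*ʳ N (E b d) (λ l → B c l * B d l))))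
                                   (sumℤ-*ˡ m (E a c) (λ d → gram B c d * E b d))) ⟩
    mul E (mul (gram B) (E ᵀ)) a b ∎
    where
    open ≡-Reasoning
    T : Fin m → Fin m → Fin N → ℤ
    T c d l = (E a c * B c l) * (E b d * B d l)
    regroup : ∀ x p q y → (x * p) * (y * q) ≡ x * ((p * q) * y)
    regroup = solve-∀

  det-gram-combineRows : ∀ {m N} (E : Matrix m) (B : Fin m → Fin N → ℤ) →
                         det (gram (combineRows E B)) ≡ det E * (det (gram B) * det E)
  det-gram-combineRows {m} E B = begin
    det (gram (combineRows E B))         ≡⟨ det-cong m (gram-combineRows E B) ⟩
    det (mul E (mul (gram B) (E ᵀ)))     ≡⟨ det-mul m E _ ⟩
    det E * det (mul (gram B) (E ᵀ))     ≡⟨ cong (det E *_) (det-mul m (gram B) (E ᵀ)) ⟩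
    det E * (det (gram B) * det (E ᵀ))   ≡⟨ cong (λ d → det E * (det (gram B) * d)) (det-ᵀ m E) ⟩
    det E * (det (gram B) * det E)       ∎
    where open ≡-Reasoning

  -- One step of integral Gram–Schmidt: the new rows B′ i are orthogonal to b₀.
  module GramSchmidtStep {m N} (B : Fin (suc m) → Fin N → ℤ) where
    b₀ = B zero
    N₀ = norm² b₀

    B′ : Fin m → Fin N → ℤ
    B′ i l = N₀ * B (suc i) l + (- dot (B (suc i)) b₀) * b₀ l

    E : Matrix (suc m)
    E zero    l       = δ zero l
    E (suc i) zero    = - dot (B (suc i)) b₀
    E (suc i) (suc k) = N₀ * δ i k

    combineRows-zero : ∀ l → combineRows E B zero l ≡ b₀ l
    combineRows-zero l = trans (sumℤ-single (suc m) zero _ (λ c c≢0 → trans (cong (_* B c l) (δ-≢ (c≢0 ∘ sym))) (*-zeroˡ (B c l))))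
                               (*-identityˡ (b₀ l))

    combineRows-suc : ∀ i l → combineRows E B (suc i) l ≡ B′ i l
    combineRows-suc i l = trans (cong (λ s → (- dot (B (suc i)) b₀) * b₀ l + s) rest) (+-comm _ (N₀ * B (suc i) l))
      where
      rest : sumℤ m (λ k → N₀ * δ i k * B (suc k) l) ≡ N₀ * B (suc i) l
      rest = trans (sumℤ-single m i _ (λ k k≢i → trans (cong (λ e → N₀ * e * B (suc k) l) (δ-≢ (k≢i ∘ sym)))
                                                       (trans (cong (_* B (suc k) l) (*-zeroʳ N₀)) (*-zeroˡ (B (suc k) l)))))
                   (trans (cong (λ e → N₀ * e * B (suc i) l) (δ-≡ i)) (cong (_* B (suc i) l) (*-identityʳ N₀)))

    det-E : det E ≡ N₀ ^ m
    det-E = begin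
      det E                                ≡⟨ det-firstRowPivot m E (λ j j≢0 → δ-≢ (j≢0 ∘ sym)) ⟩
      δ {suc m} zero zero * det (minor E zero) ≡⟨ cong (_* det (minor E zero)) (δ-≡ {suc m} zero) ⟩
      1ℤ * det (minor E zero)              ≡⟨ *-identityˡ _ ⟩
      det {m} (λ i k → N₀ * δ i k)         ≡⟨ det-scalar m N₀ ⟩
      N₀ ^ m ∎
      where open ≡-Reasoning

    det-gram-step : det (gram (combineRows E B)) ≡ N₀ * det (gram B′)
    det-gram-step = trans (det-firstRowPivot m (gram (combineRows E B)) orthogonal)
                          (cong₂ _*_ (dot-cong combineRows-zero combineRows-zero)
                                     (det-cong m λ i j → dot-cong (combineRows-suc i) (combineRows-suc j)))
      where
      orthogonal : ∀ j → j ≢ zero → gram (combineRows E B) zero j ≡ 0ℤ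
      orthogonal zero    0≢0 = ⊥-elim (0≢0 refl)
      orthogonal (suc j) _   = begin
        dot (combineRows E B zero) (combineRows E B (suc j))
          ≡⟨ dot-cong combineRows-zero (combineRows-suc j) ⟩
        dot b₀ (B′ j)
          ≡⟨ dot-linearʳ b₀ (B (suc j)) b₀ N₀ (- dot (B (suc j)) b₀) ⟩
        N₀ * dot b₀ (B (suc j)) + (- dot (B (suc j)) b₀) * N₀
          ≡⟨ cong (λ g → N₀ * g + (- dot (B (suc j)) b₀) * N₀) (dot-comm b₀ (B (suc j))) ⟩
        N₀ * dot (B (suc j)) b₀ + (- dot (B (suc j)) b₀) * N₀
          ≡⟨ cancel N₀ (dot (B (suc j)) b₀) ⟩
        0ℤ ∎
        where
        open ≡-Reasoning
        cancel : ∀ a g → a * g + (- g) * a ≡ 0ℤ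
        cancel = solve-∀

    det-gram-scaled : (N₀ ^ m * N₀ ^ m) * det (gram B) ≡ N₀ * det (gram B′)
    det-gram-scaled = begin
      (N₀ ^ m * N₀ ^ m) * det (gram B)   ≡⟨ regroup (N₀ ^ m) (det (gram B)) ⟩
      N₀ ^ m * (det (gram B) * N₀ ^ m)   ≡⟨ sym (trans (det-gram-combineRows E B) (cong (λ e → e * (det (gram B) * e)) det-E)) ⟩
      det (gram (combineRows E B))       ≡⟨ det-gram-step ⟩
      N₀ * det (gram B′) ∎
      where
      open ≡-Reasoning
      regroup : ∀ k d → (k * k) * d ≡ k * (d * k)
      regroup = solve-∀

    -- ‖B′ i‖² = N₀ (N₀ ‖bᵢ‖² - ⟨bᵢ , b₀⟩²)
    norm²-B′ : ∀ i → norm² (B′ i) ≤ (N₀ * N₀) * norm² (B (suc i))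
    norm²-B′ i = begin
      norm² (B′ i)
        ≡⟨ dot-linearˡ (B′ i) u b₀ N₀ (- g) ⟩
      N₀ * dot u (B′ i) + (- g) * dot b₀ (B′ i)
        ≡⟨ cong₂ (λ p q → N₀ * p + (- g) * q) (dot-linearʳ u u b₀ N₀ (- g)) (dot-linearʳ b₀ u b₀ N₀ (- g)) ⟩
      N₀ * (N₀ * norm² u + (- g) * g) + (- g) * (N₀ * dot b₀ u + (- g) * N₀)
        ≡⟨ cong (λ h → N₀ * (N₀ * norm² u + (- g) * g) + (- g) * (N₀ * h + (- g) * N₀)) (dot-comm b₀ u) ⟩
      N₀ * (N₀ * norm² u + (- g) * g) + (- g) * (N₀ * g + (- g) * N₀)
        ≡⟨ expand N₀ (norm² u) g ⟩
      (N₀ * N₀) * norm² u + - (N₀ * (g * g))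
        ≤⟨ +-monoʳ-≤ ((N₀ * N₀) * norm² u) (neg-mono-≤ (*-nonNeg (norm²-nonNeg b₀) (i*i-nonNeg g))) ⟩
      (N₀ * N₀) * norm² u + - 0ℤ
        ≡⟨ +-identityʳ _ ⟩
      (N₀ * N₀) * norm² u ∎
      where
      open ≤-Reasoning
      u = B (suc i)
      g = dot u b₀
      expand : ∀ a x g → a * (a * x + (- g) * g) + (- g) * (a * g + (- g) * a) ≡ (a * a) * x + - (a * (g * g))
      expand = solve-∀

  det-gram≤prod-norm² : ∀ m {N} (B : Fin m → Fin N → ℤ) → det (gram B) ≤ prodℤ m (norm² ∘ B)
  det-gram≤prod-norm² zero    B = ≤-refl
  det-gram≤prod-norm² (suc m) {N} B = by-cases (N₀ ℤ.≟ 0ℤ)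
    where
    open GramSchmidtStep B
    P = prodℤ m (norm² ∘ B ∘ suc)
    by-cases : Dec (N₀ ≡ 0ℤ) → det (gram B) ≤ N₀ * P
    by-cases (yes N₀≡0) = ≤-reflexive (begin
      det (gram B) ≡⟨ det-zeroFirstRow m (gram B) (λ j → sumℤ-zero N λ l →
                        trans (cong (_* B j l) (norm²≡0⇒≡0 b₀ N₀≡0 l)) (*-zeroˡ (B j l))) ⟩
      0ℤ           ≡⟨ sym (*-zeroˡ P) ⟩
      0ℤ * P       ≡⟨ cong (_* P) (sym N₀≡0) ⟩
      N₀ * P       ∎)
      where open ≡-Reasoning
    by-cases (no N₀≢0) = *-cancelˡ-≤-pos′ (*-pos (^-pos m N₀>0) (^-pos m N₀>0)) (begin
      (N₀ ^ m * N₀ ^ m) * det (gram B)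
        ≡⟨ det-gram-scaled ⟩
      N₀ * det (gram B′)
        ≤⟨ *-monoˡ-≤-nonNeg′ (norm²-nonNeg b₀) (det-gram≤prod-norm² m B′) ⟩
      N₀ * prodℤ m (norm² ∘ B′)
        ≤⟨ *-monoˡ-≤-nonNeg′ (norm²-nonNeg b₀) (prodℤ-mono-≤ m _ _ (norm²-nonNeg ∘ B′) norm²-B′) ⟩
      N₀ * prodℤ m (λ i → (N₀ * N₀) * norm² (B (suc i)))
        ≡⟨ cong (N₀ *_) (trans (prodℤ-scale m (N₀ * N₀) (norm² ∘ B ∘ suc)) (cong (_* P) (^-square N₀ m))) ⟩
      N₀ * ((N₀ ^ m * N₀ ^ m) * P)
        ≡⟨ regroup N₀ (N₀ ^ m) P ⟩
      (N₀ ^ m * N₀ ^ m) * (N₀ * P) ∎)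
      where
      open ≤-Reasoning
      N₀>0 : 0ℤ < N₀
      N₀>0 = ≤∧≢⇒< (norm²-nonNeg b₀) (N₀≢0 ∘ sym)
      regroup : ∀ a k p → a * ((k * k) * p) ≡ (k * k) * (a * p)
      regroup = solve-∀

  hadamard : ∀ n (A : Matrix n) → det A * det A ≤ prodℤ n (norm² ∘ A)
  hadamard n A = begin
    det A * det A     ≡⟨ cong (det A *_) (sym (det-ᵀ n A)) ⟩
    det A * det (A ᵀ) ≡⟨ sym (det-mul n A (A ᵀ)) ⟩
    det (gram A)      ≤⟨ det-gram≤prod-norm² n A ⟩
    prodℤ n (norm² ∘ A) ∎
    where open ≤-Reasoning

module BlockDiagonal where

  open Determinant
  open import Data.Nat as ℕ using (ℕ; zero; suc)
  open import Data.Integer using (ℤ; _+_; _*_; 0ℤ; 1ℤ)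
  open import Data.Integer.Properties using (*-identityˡ)
  open import Data.Integer.Tactic.RingSolver using (solve-∀)
  open import Data.Fin using (Fin; zero; suc; _↑ˡ_; splitAt)
  open import Data.Fin.Properties using (splitAt-↑ˡ; splitAt⁻¹-↑ˡ; ↑ˡ-injective)
  open import Data.Sum using (_⊎_; inj₁; inj₂; map₁)
  open import Data.Empty using (⊥-elim)
  open import Relation.Binary.PropositionalEquality
  open import Function using (_∘_)

  blockEntry : ∀ {a b} → Matrix a → Matrix b → Fin a ⊎ Fin b → Fin a ⊎ Fin b → ℤ
  blockEntry H K (inj₁ i) (inj₁ j) = H i j
  blockEntry H K (inj₁ i) (inj₂ j) = 0ℤ
  blockEntry H K (inj₂ i) (inj₁ j) = 0ℤ
  blockEntry H K (inj₂ i) (inj₂ j) = K i j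

  _⊕_ : ∀ {a b} → Matrix a → Matrix b → Matrix (a ℕ.+ b)
  _⊕_ {a} H K i j = blockEntry H K (splitAt a i) (splitAt a j)

  ⊕ˡ-isAltMultilinear : ∀ {a b} (K : Matrix b) → IsAltMultilinear a (λ H → det (H ⊕ K))
  ⊕ˡ-isAltMultilinear {a} {b} K = record
    { f-cong      = λ {H} {H′} H≗H′ → det-cong (a ℕ.+ b) λ i j → entry-cong H≗H′ (splitAt a i) (splitAt a j)
    ; rowLinear   = λ r X Y Z x y X≈Y X≈Z Xᵣ →
        det-rowLinear (a ℕ.+ b) (r ↑ˡ b) (X ⊕ K) (Y ⊕ K) (Z ⊕ K) x y
          (λ i j i≢r → entry-off X≈Y (splitAt a i) (splitAt a j) (split-≢ i≢r))
          (λ i j i≢r → entry-off X≈Z (splitAt a i) (splitAt a j) (split-≢ i≢r))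
          (λ j → trans (row X r j) (trans (entry-linear X Y Z x y r Xᵣ (splitAt a j))
                   (sym (cong₂ (λ p q → x * p + y * q) (row Y r j) (row Z r j)))))
    ; alternating = λ X r s r≢s Xᵣ≗Xₛ →
        det-alternating (a ℕ.+ b) (X ⊕ K) (r ↑ˡ b) (s ↑ˡ b) (r≢s ∘ ↑ˡ-injective b r s)
          (λ j → trans (row X r j) (trans (entry-equal Xᵣ≗Xₛ (splitAt a j)) (sym (row X s j))))
    }
    where
    entry-cong : ∀ {H H′ : Matrix a} → (∀ i j → H i j ≡ H′ i j) → ∀ s t → blockEntry H K s t ≡ blockEntry H′ K s t
    entry-cong H≗H′ (inj₁ i) (inj₁ j) = H≗H′ i j
    entry-cong H≗H′ (inj₁ i) (inj₂ j) = refl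
    entry-cong H≗H′ (inj₂ i) (inj₁ j) = refl
    entry-cong H≗H′ (inj₂ i) (inj₂ j) = refl
    entry-off : ∀ {H H′ : Matrix a} {r} → (∀ i j → i ≢ r → H i j ≡ H′ i j) →
                ∀ s t → s ≢ inj₁ r → blockEntry H K s t ≡ blockEntry H′ K s t
    entry-off H≈H′ (inj₁ i) (inj₁ j) s≢r = H≈H′ i j (s≢r ∘ cong inj₁)
    entry-off H≈H′ (inj₁ i) (inj₂ j) _   = refl
    entry-off H≈H′ (inj₂ i) (inj₁ j) _   = refl
    entry-off H≈H′ (inj₂ i) (inj₂ j) _   = refl
    entry-linear : ∀ (X Y Z : Matrix a) x y r → (∀ j → X r j ≡ x * Y r j + y * Z r j) →
                   ∀ t → blockEntry X K (inj₁ r) t ≡ x * blockEntry Y K (inj₁ r) t + y * blockEntry Z K (inj₁ r) t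
    entry-linear X Y Z x y r Xᵣ (inj₁ j) = Xᵣ j
    entry-linear X Y Z x y r Xᵣ (inj₂ j) = zeros x y
      where
      zeros : ∀ x y → 0ℤ ≡ x * 0ℤ + y * 0ℤ
      zeros = solve-∀
    entry-equal : ∀ {X : Matrix a} {r s} → (∀ j → X r j ≡ X s j) →
                  ∀ t → blockEntry X K (inj₁ r) t ≡ blockEntry X K (inj₁ s) t
    entry-equal Xᵣ≗Xₛ (inj₁ j) = Xᵣ≗Xₛ j
    entry-equal Xᵣ≗Xₛ (inj₂ j) = refl
    split-≢ : ∀ {i r} → i ≢ r ↑ˡ b → splitAt a i ≢ inj₁ r
    split-≢ i≢r eq = i≢r (sym (splitAt⁻¹-↑ˡ eq))
    row : ∀ (X : Matrix a) r j → (X ⊕ K) (r ↑ˡ b) j ≡ blockEntry X K (inj₁ r) (splitAt a j)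
    row X r j = cong (λ s → blockEntry X K s (splitAt a j)) (splitAt-↑ˡ a r b)

  det-Id⊕ : ∀ a {b} (K : Matrix b) → det (Id a ⊕ K) ≡ det K
  det-Id⊕ zero    K = refl
  det-Id⊕ (suc a) {b} K = begin
    det (Id (suc a) ⊕ K)
      ≡⟨ det-firstRowPivot (a ℕ.+ b) (Id (suc a) ⊕ K) firstRow ⟩
    δ {suc a} zero zero * det (minor (Id (suc a) ⊕ K) zero)
      ≡⟨ cong₂ _*_ (δ-≡ {suc a} zero) (det-cong (a ℕ.+ b) λ i k → lower (splitAt a i) (splitAt a k)) ⟩
    1ℤ * det (Id a ⊕ K)
      ≡⟨ *-identityˡ _ ⟩
    det (Id a ⊕ K)
      ≡⟨ det-Id⊕ a K ⟩
    det K ∎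
    where
    open ≡-Reasoning
    firstRow : ∀ j → j ≢ zero → (Id (suc a) ⊕ K) zero j ≡ 0ℤ
    firstRow zero    0≢0 = ⊥-elim (0≢0 refl)
    firstRow (suc j) _   = off (splitAt a j)
      where
      off : ∀ t → blockEntry (Id (suc a)) K (inj₁ zero) (map₁ suc t) ≡ 0ℤ
      off (inj₁ x) = δ-≢ {i = zero} {suc x} λ ()
      off (inj₂ y) = refl
    lower : ∀ s t → blockEntry (Id (suc a)) K (map₁ suc s) (map₁ suc t) ≡ blockEntry (Id a) K s t
    lower (inj₁ x) (inj₁ y) = δ-suc x y
    lower (inj₁ x) (inj₂ y) = refl
    lower (inj₂ x) (inj₁ y) = refl
    lower (inj₂ x) (inj₂ y) = refl

  det-⊕ : ∀ {a b} (H : Matrix a) (K : Matrix b) → det (H ⊕ K) ≡ det H * det K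
  det-⊕ {a} H K = trans (det-unique a (⊕ˡ-isAltMultilinear K) H) (cong (det H *_) (det-Id⊕ a K))

module AMGM where

  open import Data.Nat
  open import Data.Nat.Properties
  open import Data.Nat.Tactic.RingSolver using (solve-∀)
  open import Data.List using (List; []; _∷_; length; map)
  open import Data.List.Properties using (length-map)
  open import Data.Nat.ListAction using (sum; product)
  open import Data.Nat.ListAction.Properties using (sum-↭; product-↭)
  open import Data.List.Relation.Binary.Permutation.Propositional as ↭ using (_↭_)
  open import Data.List.Relation.Binary.Permutation.Propositional.Properties using (↭-length)
  open import Data.Product using (∃; _,_)
  open import Relation.Nullary using (yes; no; contradiction)
  open import Relation.Binary.PropositionalEquality

  record Removal (P : ℕ → Set) (xs : List ℕ) : Set where
    constructor removal
    field
      elem  : ℕ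
      rest  : List ℕ
      perm  : xs ↭ elem ∷ rest
      holds : P elem

  removeAtMostMean : ∀ a x xs → sum (x ∷ xs) ≤ length (x ∷ xs) * a → Removal (_≤ a) (x ∷ xs)
  removeAtMostMean a x xs Σ≤ with x ≤? a
  ... | yes x≤a = removal x xs ↭.refl x≤a
  removeAtMostMean a x []       Σ≤ | no x≰a =
    contradiction (≤-trans (m≤m+n x 0) (≤-trans Σ≤ (≤-reflexive (*-identityˡ a)))) x≰a
  removeAtMostMean a x (y ∷ xs) Σ≤ | no x≰a with removeAtMostMean a y xs Σ′≤
    where
    Σ′≤ : sum (y ∷ xs) ≤ length (y ∷ xs) * a
    Σ′≤ = <⇒≤ (+-cancelˡ-< a _ _ (<-≤-trans (+-monoˡ-< (sum (y ∷ xs)) (≰⇒> x≰a)) Σ≤))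
  ... | removal m rest p m≤a = removal m (x ∷ rest) (↭.trans (↭.prep x p) (↭.swap x m ↭.refl)) m≤a

  removeAtLeastMean : ∀ a x xs → length (x ∷ xs) * a ≤ sum (x ∷ xs) → Removal (a ≤_) (x ∷ xs)
  removeAtLeastMean a x xs ≤Σ with a ≤? x
  ... | yes a≤x = removal x xs ↭.refl a≤x
  removeAtLeastMean a x []       ≤Σ | no a≰x =
    contradiction (≤-trans (≤-reflexive (sym (*-identityˡ a))) (≤-trans ≤Σ (≤-reflexive (+-identityʳ x)))) a≰x
  removeAtLeastMean a x (y ∷ xs) ≤Σ | no a≰x with removeAtLeastMean a y xs ≤Σ′
    where
    ≤Σ′ : length (y ∷ xs) * a ≤ sum (y ∷ xs)
    ≤Σ′ = <⇒≤ (+-cancelˡ-< x _ _ (<-≤-trans (+-monoˡ-< (length (y ∷ xs) * a) (≰⇒> a≰x)) ≤Σ))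
  ... | removal m rest p a≤m = removal m (x ∷ rest) (↭.trans (↭.prep x p) (↭.swap x m ↭.refl)) a≤m

  -- Smoothing: the elements m ≤ m + p and m + p + q ≥ m + p are replaced by m + p and m + q,
  -- which preserves the sum and does not decrease the product.
  exchange : ∀ n m p q rest → length rest ≡ n → m + ((m + p + q) + sum rest) ≡ suc (suc n) * (m + p) →
             (∀ ys → length ys ≡ suc n → sum ys ≡ suc n * (m + p) → product ys ≤ (m + p) ^ suc n) →
             m * ((m + p + q) * product rest) ≤ (m + p) ^ suc (suc n)
  exchange n m p q rest len Σ≡ ih = begin
    m * ((m + p + q) * P)     ≤⟨ ≤-trans (m≤m+n _ (p * q * P)) (≤-reflexive (expand m p q P)) ⟩
    (m + p) * ((m + q) * P)   ≤⟨ *-monoʳ-≤ (m + p) (ih ((m + q) ∷ rest) (cong suc len) Σ′≡) ⟩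
    (m + p) * (m + p) ^ suc n ∎
    where
    open ≤-Reasoning
    P = product rest
    expand : ∀ m p q P → m * ((m + p + q) * P) + p * q * P ≡ (m + p) * ((m + q) * P)
    expand = solve-∀
    shuffle : ∀ m p q s → (m + p) + ((m + q) + s) ≡ m + ((m + p + q) + s)
    shuffle = solve-∀
    Σ′≡ : (m + q) + sum rest ≡ suc n * (m + p)
    Σ′≡ = +-cancelˡ-≡ (m + p) _ _ (trans (shuffle m p q (sum rest)) Σ≡)

  smooth : ∀ n a xs → length xs ≡ suc (suc n) → sum xs ≡ suc (suc n) * a →
           (∀ ys → length ys ≡ suc n → sum ys ≡ suc n * a → product ys ≤ a ^ suc n) →
           product xs ≤ a ^ suc (suc n)
  smooth n a (x ∷ xs) len Σ≡ ih = below (removeAtMostMean a x xs (≤-reflexive (trans Σ≡ (cong (_* a) (sym len)))))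
    where
    below : Removal (_≤ a) (x ∷ xs) → product (x ∷ xs) ≤ a ^ suc (suc n)
    below (removal m []       perm _)   = contradiction (trans (sym (↭-length perm)) len) λ ()
    below (removal m (y ∷ ys) perm m≤a) = begin
      product (x ∷ xs)     ≡⟨ product-↭ perm ⟩
      m * product (y ∷ ys) ≤⟨ above (m≤n⇒∃[o]m+o≡n m≤a) (removeAtLeastMean a y ys a≤mean) ⟩
      a ^ suc (suc n)      ∎
      where
      open ≤-Reasoning
      lenʳ : length (y ∷ ys) ≡ suc n
      lenʳ = suc-injective (trans (sym (↭-length perm)) len)
      Σʳ≡ : m + sum (y ∷ ys) ≡ suc (suc n) * a
      Σʳ≡ = trans (sym (sum-↭ perm)) Σ≡
      a≤mean : length (y ∷ ys) * a ≤ sum (y ∷ ys)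
      a≤mean = +-cancelˡ-≤ m _ _ (begin
        m + length (y ∷ ys) * a ≤⟨ +-monoˡ-≤ _ m≤a ⟩
        a + length (y ∷ ys) * a ≡⟨ cong (λ l → a + l * a) lenʳ ⟩
        suc (suc n) * a         ≡⟨ sym Σʳ≡ ⟩
        m + sum (y ∷ ys)        ∎)
      above : ∃ (λ p → m + p ≡ a) → Removal (a ≤_) (y ∷ ys) → m * product (y ∷ ys) ≤ a ^ suc (suc n)
      above (p , refl) (removal M rest perm′ a≤M) with m≤n⇒∃[o]m+o≡n a≤M
      ... | q , refl = begin
        m * product (y ∷ ys)             ≡⟨ cong (m *_) (product-↭ perm′) ⟩
        m * ((m + p + q) * product rest) ≤⟨ exchange n m p q rest (suc-injective (trans (sym (↭-length perm′)) lenʳ))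
                                              (trans (cong (m +_) (sym (sum-↭ perm′))) Σʳ≡) ih ⟩
        (m + p) ^ suc (suc n)            ∎

  product≤mean^length : ∀ n a xs → length xs ≡ n → sum xs ≡ n * a → product xs ≤ a ^ n
  product≤mean^length zero          a []       _   _  = ≤-refl
  product≤mean^length (suc zero)    a (x ∷ []) _   Σ≡ = ≤-reflexive (cong (_* 1) (+-cancelʳ-≡ 0 x a Σ≡))
  product≤mean^length (suc (suc n)) a xs       len Σ≡ = smooth n a xs len Σ≡ (λ ys → product≤mean^length (suc n) a ys)

  sum-map-* : ∀ c xs → sum (map (c *_) xs) ≡ c * sum xs
  sum-map-* c []       = sym (*-zeroʳ c)
  sum-map-* c (x ∷ xs) = trans (cong (c * x +_) (sum-map-* c xs)) (sym (*-distribˡ-+ c x (sum xs)))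

  product-map-* : ∀ c xs → product (map (c *_) xs) ≡ c ^ length xs * product xs
  product-map-* c []       = refl
  product-map-* c (x ∷ xs) = trans (cong (c * x *_) (product-map-* c xs)) (regroup c x (c ^ length xs) (product xs))
    where
    regroup : ∀ c x p q → c * x * (p * q) ≡ c * p * (x * q)
    regroup = solve-∀

  amgm : ∀ xs → product xs * length xs ^ length xs ≤ sum xs ^ length xs
  amgm xs = begin
    product xs * n ^ n      ≡⟨ *-comm (product xs) (n ^ n) ⟩
    n ^ n * product xs      ≡⟨ sym (product-map-* n xs) ⟩
    product (map (n *_) xs) ≤⟨ product≤mean^length n (sum xs) (map (n *_) xs) (length-map (n *_) xs) (sum-map-* n xs) ⟩
    sum xs ^ n              ∎
    where
    open ≤-Reasoning
    n = length xs

open import Data.Nat using (ℕ; zero; suc; _+_; _≤_; _*_; _^_)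
import Data.Nat.Properties as ℕₚ
open import Data.Nat.Divisibility using (_∣_; divides)
open import Data.Nat.Tactic.RingSolver using (solve-∀)
open import Data.Nat.ListAction using (sum; product)
open import Data.Integer as ℤ using (ℤ; -_; ∣_∣; +≤+)
import Data.Integer.Properties as ℤₚ
open import Data.Fin using (Fin; zero; suc; _↑ˡ_; _↑ʳ_; splitAt)
open import Data.Fin.Properties using (splitAt-↑ˡ; splitAt-↑ʳ)
open import Data.List using (tabulate; length)
open import Data.List.Properties using (length-tabulate)
open import Data.Bool using (if_then_else_)
open import Data.Product using (_×_; Σ; _,_)
open import Data.Sum using (_⊎_; inj₁; inj₂)
open import Relation.Nullary.Decidable using (does)
open import Relation.Binary.PropositionalEquality
open import Function using (_∘_)

open Determinant using (sumℤ-cong)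
open Hadamard using (norm²; prodℤ; hadamard; i*i≡∣i∣*∣i∣)
open BlockDiagonal using (blockEntry; _⊕_; det-⊕)
open AMGM using (amgm)

-- Chosen so that nonZeroCount A unfolds to sumℕ n (rowCount A).
nonZeroIndicator : ℤ → ℕ
nonZeroIndicator x = if does (x ℤ.≟ ℤ.+ 0) then 0 else 1

rowCount : ∀ {n} → Matrix n → Fin n → ℕ
rowCount {n} A i = sumℕ n (λ j → nonZeroIndicator (A i j))

sumℕ-cong : ∀ n {f g : Fin n → ℕ} → (∀ i → f i ≡ g i) → sumℕ n f ≡ sumℕ n g
sumℕ-cong zero    f≗g = refl
sumℕ-cong (suc n) f≗g = cong₂ _+_ (f≗g zero) (sumℕ-cong n (f≗g ∘ suc))

sumℕ-const : ∀ n c → sumℕ n (λ _ → c) ≡ n * c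
sumℕ-const zero    c = refl
sumℕ-const (suc n) c = cong (c +_) (sumℕ-const n c)

sumℕ-+ : ∀ a b (f : Fin (a + b) → ℕ) → sumℕ (a + b) f ≡ sumℕ a (f ∘ (_↑ˡ b)) + sumℕ b (f ∘ (a ↑ʳ_))
sumℕ-+ zero    b f = refl
sumℕ-+ (suc a) b f = trans (cong (f zero +_) (sumℕ-+ a b (f ∘ suc))) (sym (ℕₚ.+-assoc (f zero) _ _))

sumℕ≡sum-tabulate : ∀ n (f : Fin n → ℕ) → sumℕ n f ≡ sum (tabulate f)
sumℕ≡sum-tabulate zero    f = refl
sumℕ≡sum-tabulate (suc n) f = cong (f zero +_) (sumℕ≡sum-tabulate n (f ∘ suc))

pos-sumℕ : ∀ n (f : Fin n → ℕ) → ℤ.+ sumℕ n f ≡ sumℤ n (ℤ.+_ ∘ f)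
pos-sumℕ zero    f = refl
pos-sumℕ (suc n) f = trans (ℤₚ.pos-+ (f zero) _) (cong (ℤ._+_ (ℤ.+ f zero)) (pos-sumℕ n (f ∘ suc)))

pos-product-tabulate : ∀ n (f : Fin n → ℕ) → ℤ.+ product (tabulate f) ≡ prodℤ n (ℤ.+_ ∘ f)
pos-product-tabulate zero    f = refl
pos-product-tabulate (suc n) f = trans (ℤₚ.pos-* (f zero) _) (cong (ℤ._*_ (ℤ.+ f zero)) (pos-product-tabulate n (f ∘ suc)))

-- The upper bound

ternary-square : ∀ {x} → (x ≡ - ℤ.+ 1) ⊎ ((x ≡ ℤ.+ 0) ⊎ (x ≡ ℤ.+ 1)) → x ℤ.* x ≡ ℤ.+ nonZeroIndicator x
ternary-square (inj₁ refl)        = refl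
ternary-square (inj₂ (inj₁ refl)) = refl
ternary-square (inj₂ (inj₂ refl)) = refl

norm²-ternary : ∀ {n} (A : Matrix n) → IsTernary A → ∀ i → norm² (A i) ≡ ℤ.+ rowCount A i
norm²-ternary {n} A ternary i = trans (sumℤ-cong n (λ j → ternary-square (ternary i j))) (sym (pos-sumℕ n _))

det²≤product-rowCount : ∀ {n} (A : Matrix n) → IsTernary A → ∣ det A ∣ ^ 2 ≤ product (tabulate (rowCount A))
det²≤product-rowCount {n} A ternary = drop-+ (begin
  ℤ.+ (∣ det A ∣ ^ 2)              ≡⟨ cong (λ m → ℤ.+ (∣ det A ∣ * m)) (ℕₚ.*-identityʳ ∣ det A ∣) ⟩
  ℤ.+ (∣ det A ∣ * ∣ det A ∣)      ≡⟨ sym (i*i≡∣i∣*∣i∣ (det A)) ⟩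
  det A ℤ.* det A                  ≤⟨ hadamard n A ⟩
  prodℤ n (norm² ∘ A)              ≡⟨ prodℤ-cong n (norm²-ternary A ternary) ⟩
  prodℤ n (ℤ.+_ ∘ rowCount A)      ≡⟨ sym (pos-product-tabulate n (rowCount A)) ⟩
  ℤ.+ product (tabulate (rowCount A)) ∎)
  where
  open ℤₚ.≤-Reasoning
  drop-+ : ∀ {a b} → ℤ.+ a ℤ.≤ ℤ.+ b → a ≤ b
  drop-+ (+≤+ a≤b) = a≤b
  prodℤ-cong : ∀ m {f g : Fin m → ℤ} → (∀ i → f i ≡ g i) → prodℤ m f ≡ prodℤ m g
  prodℤ-cong zero    f≗g = refl
  prodℤ-cong (suc m) f≗g = cong₂ ℤ._*_ (f≗g zero) (prodℤ-cong m (f≗g ∘ suc))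

ternary-det-bound : ∀ n (A : Matrix n) → IsTernary A → ∣ det A ∣ ^ 2 * n ^ n ≤ nonZeroCount A ^ n
ternary-det-bound n A ternary = begin
  ∣ det A ∣ ^ 2 * n ^ n                 ≤⟨ ℕₚ.*-monoˡ-≤ (n ^ n) (det²≤product-rowCount A ternary) ⟩
  product ts * n ^ n                    ≡⟨ cong (λ m → product ts * m ^ m) (sym (length-tabulate (rowCount A))) ⟩
  product ts * length ts ^ length ts    ≤⟨ amgm ts ⟩
  sum ts ^ length ts                    ≡⟨ cong₂ _^_ (sym (sumℕ≡sum-tabulate n (rowCount A))) (length-tabulate (rowCount A)) ⟩
  nonZeroCount A ^ n                    ∎
  where
  open ℕₚ.≤-Reasoning
  ts = tabulate (rowCount A)

-- The equality case

sign⇒ternary : ∀ {k} (H : Matrix k) → IsSignMatrix H → IsTernary H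
sign⇒ternary H sign i j with sign i j
... | inj₁ H≡-1 = inj₁ H≡-1
... | inj₂ H≡1  = inj₂ (inj₂ H≡1)

nonZeroCount-sign : ∀ {k} (H : Matrix k) → IsSignMatrix H → nonZeroCount H ≡ k * k
nonZeroCount-sign {k} H sign = begin
  sumℕ k (rowCount H)      ≡⟨ sumℕ-cong k (λ i → trans (sumℕ-cong k (λ j → one (sign i j))) (sumℕ-const k 1)) ⟩
  sumℕ k (λ _ → k * 1)     ≡⟨ sumℕ-const k (k * 1) ⟩
  k * (k * 1)              ≡⟨ cong (k *_) (ℕₚ.*-identityʳ k) ⟩
  k * k                    ∎
  where
  open ≡-Reasoning
  one : ∀ {x} → (x ≡ - ℤ.+ 1) ⊎ (x ≡ ℤ.+ 1) → nonZeroIndicator x ≡ 1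
  one (inj₁ refl) = refl
  one (inj₂ refl) = refl

⊕-ternary : ∀ {a b} (H : Matrix a) (K : Matrix b) → IsTernary H → IsTernary K → IsTernary (H ⊕ K)
⊕-ternary {a} H K ternaryH ternaryK i j = entry (splitAt a i) (splitAt a j)
  where
  entry : ∀ s t → (blockEntry H K s t ≡ - ℤ.+ 1) ⊎ ((blockEntry H K s t ≡ ℤ.+ 0) ⊎ (blockEntry H K s t ≡ ℤ.+ 1))
  entry (inj₁ x) (inj₁ y) = ternaryH x y
  entry (inj₁ x) (inj₂ y) = inj₂ (inj₁ refl)
  entry (inj₂ x) (inj₁ y) = inj₂ (inj₁ refl)
  entry (inj₂ x) (inj₂ y) = ternaryK x y

nonZeroCount-⊕ : ∀ {a b} (H : Matrix a) (K : Matrix b) → nonZeroCount (H ⊕ K) ≡ nonZeroCount H + nonZeroCount K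
nonZeroCount-⊕ {a} {b} H K = trans (sumℕ-+ a b (rowCount (H ⊕ K))) (cong₂ _+_ (sumℕ-cong a upper) (sumℕ-cong b lower))
  where
  open ≡-Reasoning
  count : ∀ {i j s t} → splitAt a i ≡ s → splitAt a j ≡ t →
          nonZeroIndicator ((H ⊕ K) i j) ≡ nonZeroIndicator (blockEntry H K s t)
  count eq eq′ = cong nonZeroIndicator (cong₂ (blockEntry H K) eq eq′)
  upper : ∀ i → rowCount (H ⊕ K) (i ↑ˡ b) ≡ rowCount H i
  upper i = begin
    rowCount (H ⊕ K) (i ↑ˡ b)
      ≡⟨ sumℕ-+ a b _ ⟩
    sumℕ a (λ j → nonZeroIndicator ((H ⊕ K) (i ↑ˡ b) (j ↑ˡ b))) + sumℕ b (λ j → nonZeroIndicator ((H ⊕ K) (i ↑ˡ b) (a ↑ʳ j)))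
      ≡⟨ cong₂ _+_ (sumℕ-cong a λ j → count (splitAt-↑ˡ a i b) (splitAt-↑ˡ a j b))
                   (trans (sumℕ-cong b λ j → count (splitAt-↑ˡ a i b) (splitAt-↑ʳ a b j)) (sumℕ-const b 0)) ⟩
    rowCount H i + b * 0
      ≡⟨ cong (rowCount H i +_) (ℕₚ.*-zeroʳ b) ⟩
    rowCount H i + 0
      ≡⟨ ℕₚ.+-identityʳ _ ⟩
    rowCount H i ∎
  lower : ∀ i → rowCount (H ⊕ K) (a ↑ʳ i) ≡ rowCount K i
  lower i = begin
    rowCount (H ⊕ K) (a ↑ʳ i)
      ≡⟨ sumℕ-+ a b _ ⟩
    sumℕ a (λ j → nonZeroIndicator ((H ⊕ K) (a ↑ʳ i) (j ↑ˡ b))) + sumℕ b (λ j → nonZeroIndicator ((H ⊕ K) (a ↑ʳ i) (a ↑ʳ j)))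
      ≡⟨ cong₂ _+_ (trans (sumℕ-cong a λ j → count (splitAt-↑ʳ a b i) (splitAt-↑ˡ a j b)) (sumℕ-const a 0))
                   (sumℕ-cong b λ j → count (splitAt-↑ʳ a b i) (splitAt-↑ʳ a b j)) ⟩
    a * 0 + rowCount K i
      ≡⟨ cong (_+ rowCount K i) (ℕₚ.*-zeroʳ a) ⟩
    rowCount K i ∎

blockDiagonal : ∀ c {k} → Matrix k → Matrix (c * k)
blockDiagonal zero    H = λ ()
blockDiagonal (suc c) H = H ⊕ blockDiagonal c H

det-blockDiagonal : ∀ c {k} (H : Matrix k) → det (blockDiagonal c H) ≡ det H ℤ.^ c
det-blockDiagonal zero    H = refl
det-blockDiagonal (suc c) H = trans (det-⊕ H (blockDiagonal c H)) (cong (det H ℤ.*_) (det-blockDiagonal c H))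

blockDiagonal-ternary : ∀ c {k} (H : Matrix k) → IsTernary H → IsTernary (blockDiagonal c H)
blockDiagonal-ternary zero    H ternary = λ ()
blockDiagonal-ternary (suc c) H ternary = ⊕-ternary H (blockDiagonal c H) ternary (blockDiagonal-ternary c H ternary)

nonZeroCount-blockDiagonal : ∀ c {k} (H : Matrix k) → IsSignMatrix H → nonZeroCount (blockDiagonal c H) ≡ c * (k * k)
nonZeroCount-blockDiagonal zero    H sign = refl
nonZeroCount-blockDiagonal (suc c) H sign =
  trans (nonZeroCount-⊕ H (blockDiagonal c H)) (cong₂ _+_ (nonZeroCount-sign H sign) (nonZeroCount-blockDiagonal c H sign))

∣i^n∣≡∣i∣^n : ∀ i n → ∣ i ℤ.^ n ∣ ≡ ∣ i ∣ ^ n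
∣i^n∣≡∣i∣^n i zero    = refl
∣i^n∣≡∣i∣^n i (suc n) = trans (ℤₚ.abs-* i (i ℤ.^ n)) (cong (∣ i ∣ *_) (∣i^n∣≡∣i∣^n i n))

^-distribʳ-* : ∀ a b n → (a * b) ^ n ≡ a ^ n * b ^ n
^-distribʳ-* a b zero    = refl
^-distribʳ-* a b (suc n) = trans (cong (a * b *_) (^-distribʳ-* a b n)) (regroup a b (a ^ n) (b ^ n))
  where
  regroup : ∀ a b p q → a * b * (p * q) ≡ a * p * (b * q)
  regroup = solve-∀

blockDiagonal-extremal : ∀ c {k} (H : Matrix k) → IsHadamard k H →
                         Σ (Matrix (c * k)) (λ A → IsTernary A × nonZeroCount A ≡ k * (c * k) ×
                                                   ∣ det A ∣ ^ 2 * (c * k) ^ (c * k) ≡ (k * (c * k)) ^ (c * k))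
blockDiagonal-extremal c {k} H (sign , ∣detH∣²≡kᵏ) =
  blockDiagonal c H , blockDiagonal-ternary c H (sign⇒ternary H sign) , count , determinant
  where
  open ≡-Reasoning
  n = c * k
  count : nonZeroCount (blockDiagonal c H) ≡ k * n
  count = trans (nonZeroCount-blockDiagonal c H sign) (regroup c k)
    where
    regroup : ∀ c k → c * (k * k) ≡ k * (c * k)
    regroup = solve-∀
  determinant : ∣ det (blockDiagonal c H) ∣ ^ 2 * n ^ n ≡ (k * n) ^ n
  determinant = begin
    ∣ det (blockDiagonal c H) ∣ ^ 2 * n ^ n ≡⟨ cong (λ d → ∣ d ∣ ^ 2 * n ^ n) (det-blockDiagonal c H) ⟩
    ∣ det H ℤ.^ c ∣ ^ 2 * n ^ n              ≡⟨ cong (λ d → d ^ 2 * n ^ n) (∣i^n∣≡∣i∣^n (det H) c) ⟩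
    (∣ det H ∣ ^ c) ^ 2 * n ^ n              ≡⟨ cong (_* n ^ n) (trans (ℕₚ.^-*-assoc ∣ det H ∣ c 2)
                                                (trans (cong (∣ det H ∣ ^_) (ℕₚ.*-comm c 2)) (sym (ℕₚ.^-*-assoc ∣ det H ∣ 2 c)))) ⟩
    (∣ det H ∣ ^ 2) ^ c * n ^ n              ≡⟨ cong (λ d → d ^ c * n ^ n) ∣detH∣²≡kᵏ ⟩
    (k ^ k) ^ c * n ^ n                      ≡⟨ cong (_* n ^ n) (trans (ℕₚ.^-*-assoc k k c) (cong (k ^_) (ℕₚ.*-comm k c))) ⟩
    k ^ n * n ^ n                            ≡⟨ sym (^-distribʳ-* k n n) ⟩
    (k * n) ^ n                              ∎

k*n∣n*n⇒n≡c*k : ∀ {n k} → 1 ≤ n → k * n ∣ n * n → Σ ℕ (λ c → n ≡ c * k)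
k*n∣n*n⇒n≡c*k {suc n} {k} _ (divides c n*n≡c*[k*n]) =
  c , ℕₚ.*-cancelʳ-≡ (suc n) (c * k) (suc n) (trans n*n≡c*[k*n] (sym (ℕₚ.*-assoc c k (suc n))))

proposition8 :
    (∀ (n t : ℕ) → 1 ≤ n → (A : Matrix n) → IsTernary A → nonZeroCount A ≡ t →
      ∣ det A ∣ ^ 2 * n ^ n ≤ t ^ n)
    ×
    (∀ (n t k : ℕ) → 1 ≤ n → t ≡ k * n → t ∣ n * n →
      Σ (Matrix k) (IsHadamard k) →
      Σ (Matrix n) (λ A → IsTernary A × nonZeroCount A ≡ t × ∣ det A ∣ ^ 2 * n ^ n ≡ t ^ n))
proposition8 = bound , extremal
  where
  bound : ∀ (n t : ℕ) → 1 ≤ n → (A : Matrix n) → IsTernary A → nonZeroCount A ≡ t → ∣ det A ∣ ^ 2 * n ^ n ≤ t ^ n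
  bound n t _ A ternary refl = ternary-det-bound n A ternary
  extremal : ∀ (n t k : ℕ) → 1 ≤ n → t ≡ k * n → t ∣ n * n → Σ (Matrix k) (IsHadamard k) →
             Σ (Matrix n) (λ A → IsTernary A × nonZeroCount A ≡ t × ∣ det A ∣ ^ 2 * n ^ n ≡ t ^ n)
  extremal n t k 1≤n refl k*n∣n*n (H , hadamardH) with k*n∣n*n⇒n≡c*k {n} {k} 1≤n k*n∣n*n
  ... | c , refl = blockDiagonal-extremal c H hadamardH
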